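{- Assume $W_a$ is not of type $\widetilde{A}_2$. Let $s_i\neq s_j$ be two elements of $S=\{s_{\alpha_1},\dots,s_{\alpha_n}\}$. Then the irreducible component of $\widehat{X}_{W_a}$ containing $\iota(s_i)$ is different from the irreducible component containing $\iota(s_j)$.
   Context: Let $V$ be a Euclidean space with inner product $(\cdot,\cdot)$, $\Phi\subset V$ an irreducible crystallographic root system spanning $V$, short roots of norm $1$; $\Delta=\{\alpha_1,\dots,\alpha_n\}$, $\Phi^+$ ($|\Phi^+|=m$), $W$ the Weyl group with Coxeter generators $S=\{s_{\alpha_1},\dots,s_{\alpha_n}\}$, $s_\alpha$ the reflection in $\alpha^\perp$. $\alpha^\vee=2\alpha/(\alpha,\alpha)$; $s_{\alpha,k}(x)=x-\big(\tfrac{2(\alpha,x)}{(\alpha,\alpha)}-k\big)\alpha$; $W_a=\langle s_{\alpha,k}\rangle$ the affine Weyl group. For $\alpha\in\Phi^+$, $H^1_{\alpha,k}=\{v:k<(v,\alpha^\vee)<k+1\}$; alcoves are connected components of $V$ minus all $\{(v,\alpha^\vee)=k\}$, $A_e=\bigcap_{\alpha\in\Phi^+}H^1_{\alpha,0}$, $A_w=w(A_e)$, $k(w,\alpha)$ defined by $A_w=\bigcap_{\alpha\in\Phi^+}H^1_{\alpha,k(w,\alpha)}$, $\iota(w)=(k(w,\alpha))_{\alpha\in\Phi^+}\in\mathbb{R}^m$. Height $h(\theta^\vee)=\sum c_i$ for $\theta^\vee=\sum_ic_i\alpha_i^\vee$; $P_\theta=\sum_ic_iX_{\alpha_i}$;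 $I_\theta=\{0,\dots,h(\theta^\vee)-1\}$; $P_\theta[\lambda_\theta]=P_\theta+\lambda_\theta-X_\theta$. $\lambda\in\mathbb{N}^m$ is admissible if $\lambda_\alpha\in I_\alpha$ for all $\alpha\in\Phi^+$, and then $X_{W_a}[\lambda]\subset\mathbb{R}^m$ is the common zero set of the $P_\alpha[\lambda_\alpha]$. $\lambda$ is admitted if it moreover satisfies $\lambda_\alpha+\lambda_\beta\le\lambda_\gamma\le\lambda_\alpha+\lambda_\beta+1$ whenever $\alpha,\beta,\gamma\in\Phi^+$ with $\alpha^\vee+\beta^\vee=\gamma^\vee$. $\widehat{X}_{W_a}=\bigsqcup_{\lambda\text{ admitted}}X_{W_a}[\lambda]$, whose irreducible components are the $X_{W_a}[\lambda]$; every $\iota(w)$, $w\in W_a$, lies in exactly one of them.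
   Formalization: The Euclidean space $V$ is taken as ℚ^n with a positive-definite inner product taking rational values, rather than a real inner product space. -}

module Defs where

open import Data.Nat as ℕ using (ℕ; zero; suc)
open import Data.Integer as ℤ using (ℤ)
open import Data.Rational as ℚ using (ℚ; 0ℚ; 1ℚ; _+_; _*_; _-_; -_; _<_; _≤_; _/_)
open import Data.Rational.Properties using (_≟_)
open import Data.Fin using (Fin)
open import Data.Vec using (Vec; zipWith; map; replicate)
open import Data.Bool using (Bool; true; false)
open import Data.Product using (Σ; ∃; _×_; _,_)
open import Data.Sum using (_⊎_)
open import Relation.Binary.PropositionalEquality using (_≡_; _≢_)
open import Relation.Nullary using (¬_; yes; no)

V : ℕ → Set
V n = Vec ℚ n

0v : ∀ {n} → V n
0v = replicate _ 0ℚ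

infixl 6 _⊕_
_⊕_ : ∀ {n} → V n → V n → V n
_⊕_ = zipWith _+_

infixr 7 _·_
_·_ : ∀ {n} → ℚ → V n → V n
c · v = map (c *_) v

ℤ→ℚ : ℤ → ℚ
ℤ→ℚ z = z / 1

ℕ→ℚ : ℕ → ℚ
ℕ→ℚ k = ℤ.+ k / 1

sumℚ : ∀ {k} → (Fin k → ℚ) → ℚ
sumℚ {zero}  f = 0ℚ
sumℚ {suc k} f = f Fin.zero + sumℚ (λ i → f (Fin.suc i))
  where import Data.Fin as Fin

linComb : ∀ {n k} → (Fin k → ℚ) → (Fin k → V n) → V n
linComb {k = zero}  c v = 0v
linComb {k = suc k} c v = c Fin.zero · v Fin.zero ⊕ linComb (λ i → c (Fin.suc i)) (λ i → v (Fin.suc i))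
  where import Data.Fin as Fin

-- total inverse (1/q for q ≠ 0, and 0 for q = 0); only ever applied to
-- (α,α) > 0 for a root α
inv : ℚ → ℚ
inv q with q ≟ 0ℚ
... | yes _  = 0ℚ
... | no q≢0 = ℚ.1/_ q {{ℚ.≢-nonZero q≢0}}

record InnerProduct (n : ℕ) : Set where
  field
    ⟪_,_⟫    : V n → V n → ℚ
    symm     : ∀ u v → ⟪ u , v ⟫ ≡ ⟪ v , u ⟫
    additive : ∀ u v w → ⟪ u ⊕ v , w ⟫ ≡ ⟪ u , w ⟫ + ⟪ v , w ⟫
    homog    : ∀ c u w → ⟪ c · u , w ⟫ ≡ c * ⟪ u , w ⟫
    posdef   : ∀ u → u ≢ 0v → 0ℚ < ⟪ u , u ⟫

module _ {n : ℕ} (ip : InnerProduct n) where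
  open InnerProduct ip

  coroot : V n → V n
  coroot α = (ℤ→ℚ (ℤ.+ 2) * inv ⟪ α , α ⟫) · α

  refl : V n → V n → V n
  refl α x = x ⊕ (- (⟪ x , coroot α ⟫)) · α

-- Irreducible crystallographic (reduced) root systems spanning ℚ^n,
-- short roots of norm 1.  Φ = {root a | a : Fin N}.

record RootSystem {n : ℕ} (ip : InnerProduct n) : Set where
  open InnerProduct ip
  field
    N          : ℕ
    root       : Fin N → V n
    root-inj   : ∀ a b → root a ≡ root b → a ≡ b
    nonzero    : ∀ a → root a ≢ 0v
    spans      : ∀ v → ∃ λ (c : Fin N → ℚ) → v ≡ linComb c root
    reduced    : ∀ a b (c : ℚ) → root b ≡ c · root a → (c ≡ 1ℚ) ⊎ (c ≡ - 1ℚ)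
    refl-closed : ∀ a b → ∃ λ c → root c ≡ refl ip (root a) (root b)
    integral   : ∀ a b → ∃ λ (z : ℤ) → ⟪ root b , coroot ip (root a) ⟫ ≡ ℤ→ℚ z
    irreducible : ∀ (P : Fin N → Bool) →
                  (∀ a b → P a ≡ true → P b ≡ false → ⟪ root a , root b ⟫ ≡ 0ℚ) →
                  (∀ a → P a ≡ true) ⊎ (∀ a → P a ≡ false)
    short≥1    : ∀ a → 1ℚ ≤ ⟪ root a , root a ⟫
    short≡1    : ∃ λ a → ⟪ root a , root a ⟫ ≡ 1ℚ

record Base {n : ℕ} {ip : InnerProduct n} (R : RootSystem ip) : Set where
  open RootSystem R
  field
    simple      : Fin n → Fin N
    independent : ∀ (c : Fin n → ℚ) → linComb c (λ i → root (simple i)) ≡ 0v → ∀ i → c i ≡ 0ℚ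
    signed      : ∀ b → ∃ λ (c : Fin n → ℤ) →
                    (root b ≡ linComb (λ i → ℤ→ℚ (c i)) (λ i → root (simple i))) ×
                    ((∀ i → ℤ.+ 0 ℤ.≤ c i) ⊎ (∀ i → c i ℤ.≤ ℤ.+ 0))

module _ {n : ℕ} {ip : InnerProduct n} {R : RootSystem ip} (Δ : Base R) where
  open InnerProduct ip
  open RootSystem R
  open Base Δ

  αs : Fin n → V n
  αs i = root (simple i)

  Positive : Fin N → Set
  Positive b = ∃ λ (c : Fin n → ℤ) →
    (root b ≡ linComb (λ i → ℤ→ℚ (c i)) αs) × (∀ i → ℤ.+ 0 ℤ.≤ c i)

  pair : V n → V n → ℚ
  pair v α = ⟪ v , coroot ip α ⟫

  -- c are the coordinates of θ^∨ in the simple coroots: θ^∨ = Σ c_i α_i^∨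
  -- (then h(θ^∨) = Σ c_i and P_θ = Σ c_i X_{α_i})
  CorootCoeffs : Fin N → (Fin n → ℚ) → Set
  CorootCoeffs b c = coroot ip (root b) ≡ linComb c (λ i → coroot ip (αs i))

  -- W_a is of type Ã₂, i.e. Φ is of type A₂: rank 2, Cartan entries −1
  IsTypeA2 : Set
  IsTypeA2 = (n ≡ 2) × (∀ i j → i ≢ j → pair (αs i) (αs j) ≡ - 1ℚ)

  InAe : V n → Set
  InAe v = ∀ b → Positive b → (0ℚ < pair v (root b)) × (pair v (root b) < 1ℚ)

  -- k : Fin N → ℤ restricted to Φ^+ is ι(s_i), i.e. k(s_i,α) for α ∈ Φ^+:
  -- A_{s_i} = s_i(A_e) ⊆ H^1_{α,k α}
  IsIotaSimple : Fin n → (Fin N → ℤ) → Set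
  IsIotaSimple i k = ∀ b → Positive b → ∀ v → InAe v →
    (ℤ→ℚ (k b) < pair (refl ip (αs i) v) (root b)) ×
    (pair (refl ip (αs i) v) (root b) < ℤ→ℚ (k b) + 1ℚ)

  Admitted : (Fin N → ℕ) → Set
  Admitted lam =
    (∀ b → Positive b → ∀ c → CorootCoeffs b c → ℕ→ℚ (lam b) < sumℚ c) ×
    (∀ a b g → Positive a → Positive b → Positive g →
       coroot ip (root a) ⊕ coroot ip (root b) ≡ coroot ip (root g) →
       (lam a ℕ.+ lam b ℕ.≤ lam g) × (lam g ℕ.≤ lam a ℕ.+ lam b ℕ.+ 1))

  -- x ∈ X_{W_a}[λ] for x = (x_α)_{α ∈ Φ^+} with integer entries:
  -- P_θ[λ_θ](x) = Σ c_i x_{α_i} + λ_θ − x_θ = 0 for all θ ∈ Φ^+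
  InX : (Fin N → ℕ) → (Fin N → ℤ) → Set
  InX lam x = ∀ b → Positive b → ∀ c → CorootCoeffs b c →
    sumℚ (λ i → c i * ℤ→ℚ (x (simple i))) + ℕ→ℚ (lam b) - ℤ→ℚ (x b) ≡ 0ℚ

-- ι(s_i) is −1 at α_i and 0 at every other positive root: evaluate it at a point of the
-- fundamental alcove (a small multiple of ρ = Σ Φ⁺) and use that s_i permutes Φ⁺ ∖ {α_i}.
-- Substituting this into P_θ[λ_θ] = 0 shows that ι(s_i) ∈ X[λ] forces λ_θ to be the
-- α_i^∨-coordinate of θ^∨ for every positive θ ≠ α_i. So if ι(s_i) and ι(s_j) lie in the
-- same X[λ], the α_i^∨- and α_j^∨-coordinates of θ^∨ agree for every non-simple positive θ.
-- For adjacent vertices l, k of the Dynkin diagram, θ = s_k(α_l) has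
-- θ^∨ = α_l^∨ − ⟨α_k, α_l^∨⟩ α_k^∨. Since Φ is irreducible the diagram is connected, and one
-- of these roots separates i from j unless the diagram is i — j with both Cartan integers
-- equal to −1, i.e. unless Φ has type A₂.

module Submission where

import Algebra.Bundles
open import Data.Bool using (Bool; true; false)
import Data.Bool.Properties as Boolₚ
open import Data.Empty using (⊥; ⊥-elim)
open import Data.Fin as Fin using (Fin)
import Data.Fin.Permutation as Perm
import Data.Fin.Properties as Finₚ
open import Data.Integer as ℤ using (ℤ)
import Data.Integer.Properties as ℤₚ
open import Data.Nat as ℕ using (ℕ; zero; suc)
import Data.Nat.Coprimality as Coprime
import Data.Nat.Properties as ℕₚ
open import Data.Product using (Σ; ∃; _×_; _,_; proj₁; proj₂; map₂)
open import Data.Rational as ℚ using (ℚ; 0ℚ; 1ℚ; ½; mkℚ; _+_; _*_; _-_; -_; _<_; _≤_; ∣_∣)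
import Data.Rational.Properties as ℚₚ
open import Data.Rational.Solver using (module +-*-Solver)
open import Data.Sum using (_⊎_; inj₁; inj₂; [_,_]′)
open import Data.Vec using (lookup)
import Data.Vec.Properties as Vecₚ
open import Relation.Binary.PropositionalEquality
open import Relation.Nullary using (¬_; yes; no; Dec; does; ¬?)
open import Relation.Unary using (Decidable)
open import Relation.Nullary.Decidable using (_×-dec_; _⊎-dec_; decidable-stable)
open import Algebra.Properties.Group ℚₚ.+-0-group using () renaming (⁻¹-involutive to neg-involutive)
open import Algebra.Properties.Semiring.Sum (Algebra.Bundles.Ring.semiring ℚₚ.+-*-ring)
  using (sum; sum-cong-≗; ∑-distrib-+; *-distribˡ-sum; sum-permute; sum-remove)

open import Defs hiding (refl)
open import Defs using () renaming (refl to reflection)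

open +-*-Solver

ℤ→ℚ≡mkℚ : ∀ z → ℤ→ℚ z ≡ mkℚ z 0 (Coprime.sym (Coprime.1-coprimeTo _))
ℤ→ℚ≡mkℚ z = ℚₚ.↥p/↧p≡p (mkℚ z 0 (Coprime.sym (Coprime.1-coprimeTo _)))

ℤ→ℚ-mono-≤ : ∀ {a b} → a ℤ.≤ b → ℤ→ℚ a ≤ ℤ→ℚ b
ℤ→ℚ-mono-≤ {a} {b} a≤b rewrite ℤ→ℚ≡mkℚ a | ℤ→ℚ≡mkℚ b =
  ℚ.*≤* (subst₂ ℤ._≤_ (sym (ℤₚ.*-identityʳ a)) (sym (ℤₚ.*-identityʳ b)) a≤b)

ℤ→ℚ-cancel-< : ∀ {a b} → ℤ→ℚ a < ℤ→ℚ b → a ℤ.< b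
ℤ→ℚ-cancel-< {a} {b} a<b rewrite ℤ→ℚ≡mkℚ a | ℤ→ℚ≡mkℚ b with a<b
... | ℚ.*<* a*1<b*1 = subst₂ ℤ._<_ (ℤₚ.*-identityʳ a) (ℤₚ.*-identityʳ b) a*1<b*1

ℤ→ℚ-+ : ∀ a b → ℤ→ℚ (a ℤ.+ b) ≡ ℤ→ℚ a + ℤ→ℚ b
ℤ→ℚ-+ a b rewrite ℤ→ℚ≡mkℚ a | ℤ→ℚ≡mkℚ b =
  cong (ℚ._/ 1) (sym (cong₂ ℤ._+_ (ℤₚ.*-identityʳ a) (ℤₚ.*-identityʳ b)))

ℤ→ℚ-neg : ∀ z → ℤ→ℚ (ℤ.- z) ≡ - ℤ→ℚ z
ℤ→ℚ-neg z rewrite ℤ→ℚ≡mkℚ (ℤ.- z) | ℤ→ℚ≡mkℚ z with z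
... | ℤ.+ zero    = refl
... | ℤ.+ (suc _) = refl
... | ℤ.-[1+ _ ]  = refl

ℤ→ℚ-suc : ∀ z → ℤ→ℚ (ℤ.suc z) ≡ ℤ→ℚ z + 1ℚ
ℤ→ℚ-suc z = trans (ℤ→ℚ-+ (ℤ.+ 1) z) (ℚₚ.+-comm 1ℚ (ℤ→ℚ z))

ℤ→ℚ-interval-unique : ∀ k m {x} →
  ℤ→ℚ k < x → x < ℤ→ℚ k + 1ℚ → ℤ→ℚ m < x → x < ℤ→ℚ m + 1ℚ → k ≡ m
ℤ→ℚ-interval-unique k m k<x x<k+1 m<x x<m+1 =
  ℤₚ.≤-antisym (<suc⇒≤ (below k m k<x x<m+1)) (<suc⇒≤ (below m k m<x x<k+1))
  where
  below : ∀ a b {x} → ℤ→ℚ a < x → x < ℤ→ℚ b + 1ℚ → a ℤ.< ℤ.suc b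
  below a b a<x x<b+1 =
    ℤ→ℚ-cancel-< {a} {ℤ.suc b} (ℚₚ.<-trans a<x (subst (_ <_) (sym (ℤ→ℚ-suc b)) x<b+1))
  <suc⇒≤ : ∀ {a b} → a ℤ.< ℤ.suc b → a ℤ.≤ b
  <suc⇒≤ a<1+b = ℤₚ.≮⇒≥ (λ b<a → ℤₚ.<-irrefl refl (ℤₚ.<-≤-trans a<1+b (ℤₚ.i<j⇒suc[i]≤j b<a)))

ℤ→ℚ-pos⇒≥1 : ∀ z → 0ℚ < ℤ→ℚ z → 1ℚ ≤ ℤ→ℚ z
ℤ→ℚ-pos⇒≥1 z 0<z = ℤ→ℚ-mono-≤ (ℤₚ.i<j⇒suc[i]≤j (ℤ→ℚ-cancel-< {ℤ.+ 0} {z} 0<z))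

ℕ→ℚ-suc : ∀ h → ℕ→ℚ (suc h) ≡ ℕ→ℚ h + 1ℚ
ℕ→ℚ-suc h = ℤ→ℚ-suc (ℤ.+ h)

ℕ→ℚ-unbounded : ∀ q → ∃ λ h → q ≤ ℕ→ℚ h
ℕ→ℚ-unbounded q@(mkℚ (ℤ.+ m) d _) = m , subst (q ≤_) (sym (ℤ→ℚ≡mkℚ (ℤ.+ m))) (ℚ.*≤* m*1≤m*[1+d])
  where
  m*1≤m*[1+d] : ℤ.+ m ℤ.* ℤ.+ 1 ℤ.≤ ℤ.+ m ℤ.* ℤ.+ suc d
  m*1≤m*[1+d] = subst₂ ℤ._≤_ (sym (ℤₚ.*-identityʳ (ℤ.+ m))) (ℤₚ.pos-* m (suc d))
                         (ℤ.+≤+ (ℕₚ.m≤m*n m (suc d)))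
ℕ→ℚ-unbounded q@(mkℚ ℤ.-[1+ m ] d _) = 0 , subst (q ≤_) (sym (ℤ→ℚ≡mkℚ (ℤ.+ 0))) (ℚ.*≤* -m*1≤0)
  where
  -m*1≤0 : ℤ.-[1+ m ] ℤ.* ℤ.+ 1 ℤ.≤ ℤ.+ 0 ℤ.* ℤ.+ suc d
  -m*1≤0 = subst (ℤ._≤ ℤ.+ 0) (sym (ℤₚ.*-identityʳ ℤ.-[1+ m ])) ℤ.-≤+

+1≤suc⇒≤ : ∀ q h → q + 1ℚ ≤ ℕ→ℚ (suc h) → q ≤ ℕ→ℚ h
+1≤suc⇒≤ q h q+1≤h+1 = begin
  q                        ≡⟨ solve 1 (λ q → q := (q :+ con 1ℚ) :+ (:- con 1ℚ)) refl q ⟩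
  (q + 1ℚ) + - 1ℚ          ≤⟨ ℚₚ.+-monoˡ-≤ (- 1ℚ) (subst (q + 1ℚ ≤_) (ℕ→ℚ-suc h) q+1≤h+1) ⟩
  (ℕ→ℚ h + 1ℚ) + - 1ℚ      ≡⟨ solve 1 (λ x → (x :+ con 1ℚ) :+ (:- con 1ℚ) := x) refl (ℕ→ℚ h) ⟩
  ℕ→ℚ h                    ∎
  where open ℚₚ.≤-Reasoning

nonNeg+1≰0 : ∀ q → 0ℚ ≤ q → ¬ (q + 1ℚ ≤ 0ℚ)
nonNeg+1≰0 q 0≤q q+1≤0 = 1≰0 (ℚₚ.≤-trans (ℚₚ.+-monoˡ-≤ 1ℚ 0≤q) q+1≤0)
  where
  1≰0 : ¬ (1ℚ ≤ 0ℚ)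
  1≰0 (ℚ.*≤* (ℤ.+≤+ ()))

*-pos : ∀ {a b} → 0ℚ < a → 0ℚ < b → 0ℚ < a * b
*-pos {a} {b} 0<a 0<b =
  ℚₚ.positive⁻¹ _ {{ℚₚ.pos*pos⇒pos a {{ℚ.positive 0<a}} b {{ℚ.positive 0<b}}}}

*-nonNeg : ∀ {a b} → 0ℚ ≤ a → 0ℚ ≤ b → 0ℚ ≤ a * b
*-nonNeg {a} {b} 0≤a 0≤b =
  ℚₚ.nonNegative⁻¹ _ {{ℚₚ.nonNeg*nonNeg⇒nonNeg a {{ℚ.nonNegative 0≤a}} b {{ℚ.nonNegative 0≤b}}}}

*-nonNeg-nonPos : ∀ {a b} → 0ℚ ≤ a → b ≤ 0ℚ → a * b ≤ 0ℚ
*-nonNeg-nonPos {a} {b} 0≤a b≤0 =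
  ℚₚ.nonPositive⁻¹ _ {{ℚₚ.nonNeg*nonPos⇒nonPos a {{ℚ.nonNegative 0≤a}} b {{ℚ.nonPositive b≤0}}}}

pos*x≡0⇒x≡0 : ∀ a x → 0ℚ < a → a * x ≡ 0ℚ → x ≡ 0ℚ
pos*x≡0⇒x≡0 a x 0<a ax≡0 = begin
  x                  ≡⟨ sym (ℚₚ.*-identityˡ x) ⟩
  1ℚ * x             ≡⟨ cong (_* x) (sym (ℚₚ.*-inverseˡ a)) ⟩
  (ℚ.1/ a) * a * x   ≡⟨ ℚₚ.*-assoc (ℚ.1/ a) a x ⟩
  (ℚ.1/ a) * (a * x) ≡⟨ cong ((ℚ.1/ a) *_) ax≡0 ⟩
  (ℚ.1/ a) * 0ℚ      ≡⟨ ℚₚ.*-zeroʳ (ℚ.1/ a) ⟩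
  0ℚ                 ∎
  where
  open ≡-Reasoning
  instance
    a≢0 : ℚ.NonZero a
    a≢0 = ℚₚ.pos⇒nonZero a {{ℚ.positive 0<a}}

x≡-x⇒x≡0 : ∀ x → x ≡ - x → x ≡ 0ℚ
x≡-x⇒x≡0 x x≡-x = begin
  x              ≡⟨ solve 1 (λ x → x := con ½ :* (x :+ x)) refl x ⟩
  ½ * (x + x)    ≡⟨ cong (λ y → ½ * (x + y)) x≡-x ⟩
  ½ * (x + - x)  ≡⟨ solve 1 (λ x → con ½ :* (x :- x) := con 0ℚ) refl x ⟩
  0ℚ             ∎
  where open ≡-Reasoning

-1*x≡-x : ∀ x → (- 1ℚ) * x ≡ - x
-1*x≡-x x = solve 1 (λ x → con (- 1ℚ) :* x := :- x) refl x

0≢1 : 0ℚ ≢ 1ℚ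
0≢1 ()

1≢0 : 1ℚ ≢ 0ℚ
1≢0 ()

0≰-1 : ¬ (0ℚ ≤ - 1ℚ)
0≰-1 (ℚ.*≤* ())

x-y≡0⇒x≡y : ∀ x y → x + (- 1ℚ) * y ≡ 0ℚ → x ≡ y
x-y≡0⇒x≡y x y x-y≡0 = begin
  x                      ≡⟨ solve 2 (λ x y → x := (x :+ con (- 1ℚ) :* y) :+ y) refl x y ⟩
  (x + (- 1ℚ) * y) + y   ≡⟨ cong (_+ y) x-y≡0 ⟩
  0ℚ + y                 ≡⟨ ℚₚ.+-identityˡ y ⟩
  y                      ∎
  where open ≡-Reasoning

inv-inverseˡ : ∀ q → q ≢ 0ℚ → inv q * q ≡ 1ℚ
inv-inverseˡ q q≢0 with q ℚₚ.≟ 0ℚ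
... | yes q≡0 = ⊥-elim (q≢0 q≡0)
... | no  q≢0 = ℚₚ.*-inverseˡ q {{ℚ.≢-nonZero q≢0}}

inv-pos : ∀ q → 0ℚ < q → 0ℚ < inv q
inv-pos q 0<q with q ℚₚ.≟ 0ℚ
... | yes q≡0 = ⊥-elim (ℚₚ.<⇒≢ 0<q (sym q≡0))
... | no  q≢0 = ℚₚ.positive⁻¹ _ {{ℚₚ.1/pos⇒pos q {{ℚ.positive 0<q}}}}

sumℚ≡sum : ∀ {k} (f : Fin k → ℚ) → sumℚ f ≡ sum f
sumℚ≡sum {zero}  f = refl
sumℚ≡sum {suc k} f = cong (f Fin.zero +_) (sumℚ≡sum (λ i → f (Fin.suc i)))

sumℚ-cong : ∀ {k} {f g : Fin k → ℚ} → (∀ i → f i ≡ g i) → sumℚ f ≡ sumℚ g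
sumℚ-cong {f = f} {g} f≗g = trans (sumℚ≡sum f) (trans (sum-cong-≗ f≗g) (sym (sumℚ≡sum g)))

sumℚ-+ : ∀ {k} (f g : Fin k → ℚ) → sumℚ (λ i → f i + g i) ≡ sumℚ f + sumℚ g
sumℚ-+ f g = trans (sumℚ≡sum (λ i → f i + g i))
                   (trans (∑-distrib-+ f g) (sym (cong₂ _+_ (sumℚ≡sum f) (sumℚ≡sum g))))

sumℚ-*ˡ : ∀ {k} (r : ℚ) (f : Fin k → ℚ) → sumℚ (λ i → r * f i) ≡ r * sumℚ f
sumℚ-*ˡ r f = trans (sumℚ≡sum (λ i → r * f i))
                    (trans (sym (*-distribˡ-sum r f)) (cong (r *_) (sym (sumℚ≡sum f))))

sumℚ-permute : ∀ {k} (f : Fin k → ℚ) (π : Perm.Permutation k k) →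
               sumℚ f ≡ sumℚ (λ i → f (π Perm.⟨$⟩ʳ i))
sumℚ-permute f π =
  trans (sumℚ≡sum f) (trans (sum-permute f π) (sym (sumℚ≡sum (λ i → f (π Perm.⟨$⟩ʳ i)))))

sumℚ-zero : ∀ {k} (f : Fin k → ℚ) → (∀ i → f i ≡ 0ℚ) → sumℚ f ≡ 0ℚ
sumℚ-zero {zero}  f f≗0 = refl
sumℚ-zero {suc k} f f≗0 =
  cong₂ _+_ (f≗0 Fin.zero) (sumℚ-zero (λ i → f (Fin.suc i)) (λ i → f≗0 (Fin.suc i)))

sumℚ-mono-≤ : ∀ {k} (f g : Fin k → ℚ) → (∀ i → f i ≤ g i) → sumℚ f ≤ sumℚ g
sumℚ-mono-≤ {zero}  f g f≤g = ℚₚ.≤-refl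
sumℚ-mono-≤ {suc k} f g f≤g = ℚₚ.+-mono-≤ (f≤g Fin.zero) (sumℚ-mono-≤ _ _ (λ i → f≤g (Fin.suc i)))

sumℚ-nonNeg : ∀ {k} (f : Fin k → ℚ) → (∀ i → 0ℚ ≤ f i) → 0ℚ ≤ sumℚ f
sumℚ-nonNeg {k} f 0≤f =
  subst (_≤ sumℚ f) (sumℚ-zero {k} (λ _ → 0ℚ) (λ _ → refl)) (sumℚ-mono-≤ (λ _ → 0ℚ) f 0≤f)

sumℚ-nonPos : ∀ {k} (f : Fin k → ℚ) → (∀ i → f i ≤ 0ℚ) → sumℚ f ≤ 0ℚ
sumℚ-nonPos {k} f f≤0 =
  subst (sumℚ f ≤_) (sumℚ-zero {k} (λ _ → 0ℚ) (λ _ → refl)) (sumℚ-mono-≤ f (λ _ → 0ℚ) f≤0)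

term≤sumℚ : ∀ {k} (f : Fin k → ℚ) → (∀ i → 0ℚ ≤ f i) → ∀ t → f t ≤ sumℚ f
term≤sumℚ {suc k} f 0≤f t = begin
  f t               ≡⟨ sym (ℚₚ.+-identityʳ (f t)) ⟩
  f t + 0ℚ          ≤⟨ ℚₚ.+-monoʳ-≤ (f t) (sumℚ-nonNeg rest (λ i → 0≤f (Fin.punchIn t i))) ⟩
  f t + sumℚ rest   ≡⟨ cong (f t +_) (sumℚ≡sum rest) ⟩
  f t + sum rest    ≡⟨ sym (sum-remove f) ⟩
  sum f             ≡⟨ sym (sumℚ≡sum f) ⟩
  sumℚ f            ∎
  where
  open ℚₚ.≤-Reasoning
  rest = λ i → f (Fin.punchIn t i)

δℤ : ∀ {k} → Fin k → Fin k → ℤ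
δℤ Fin.zero    Fin.zero    = ℤ.+ 1
δℤ Fin.zero    (Fin.suc _) = ℤ.+ 0
δℤ (Fin.suc _) Fin.zero    = ℤ.+ 0
δℤ (Fin.suc s) (Fin.suc t) = δℤ s t

δℤ-nonNeg : ∀ {k} (s t : Fin k) → ℤ.+ 0 ℤ.≤ δℤ s t
δℤ-nonNeg Fin.zero    Fin.zero    = ℤ.+≤+ ℕ.z≤n
δℤ-nonNeg Fin.zero    (Fin.suc t) = ℤ.+≤+ ℕ.z≤n
δℤ-nonNeg (Fin.suc s) Fin.zero    = ℤ.+≤+ ℕ.z≤n
δℤ-nonNeg (Fin.suc s) (Fin.suc t) = δℤ-nonNeg s t

δ : ∀ {k} → Fin k → Fin k → ℚ
δ s t = ℤ→ℚ (δℤ s t)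

δ-diag : ∀ {k} (t : Fin k) → δ t t ≡ 1ℚ
δ-diag Fin.zero    = refl
δ-diag (Fin.suc t) = δ-diag t

δ-off : ∀ {k} (s t : Fin k) → s ≢ t → δ s t ≡ 0ℚ
δ-off Fin.zero    Fin.zero    s≢t = ⊥-elim (s≢t refl)
δ-off Fin.zero    (Fin.suc t) s≢t = refl
δ-off (Fin.suc s) Fin.zero    s≢t = refl
δ-off (Fin.suc s) (Fin.suc t) s≢t = δ-off s t (λ s≡t → s≢t (cong Fin.suc s≡t))

+*δ-off : ∀ {k} (t u : Fin k) x r → t ≢ u → x + r * δ t u ≡ x
+*δ-off t u x r t≢u =
  trans (cong (λ d → x + r * d) (δ-off t u t≢u)) (trans (cong (x +_) (ℚₚ.*-zeroʳ r)) (ℚₚ.+-identityʳ x))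

sumℚ-δ : ∀ {k} (t : Fin k) (f : Fin k → ℚ) → sumℚ (λ i → δ t i * f i) ≡ f t
sumℚ-δ {suc k} Fin.zero f = begin
  1ℚ * f Fin.zero + sumℚ (λ i → 0ℚ * f (Fin.suc i))
    ≡⟨ cong₂ _+_ (ℚₚ.*-identityˡ (f Fin.zero))
                 (sumℚ-zero (λ i → 0ℚ * f (Fin.suc i)) (λ i → ℚₚ.*-zeroˡ (f (Fin.suc i)))) ⟩
  f Fin.zero + 0ℚ  ≡⟨ ℚₚ.+-identityʳ (f Fin.zero) ⟩
  f Fin.zero       ∎
  where open ≡-Reasoning
sumℚ-δ {suc k} (Fin.suc t) f = begin
  0ℚ * f Fin.zero + sumℚ (λ i → δ t i * f (Fin.suc i))
    ≡⟨ cong₂ _+_ (ℚₚ.*-zeroˡ (f Fin.zero)) (sumℚ-δ t (λ i → f (Fin.suc i))) ⟩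
  0ℚ + f (Fin.suc t)  ≡⟨ ℚₚ.+-identityˡ (f (Fin.suc t)) ⟩
  f (Fin.suc t)       ∎
  where open ≡-Reasoning

sumℚ-δ-one : ∀ {k} (t : Fin k) → sumℚ (δ t) ≡ 1ℚ
sumℚ-δ-one t = trans (sumℚ-cong (λ i → sym (ℚₚ.*-identityʳ (δ t i)))) (sumℚ-δ t (λ _ → 1ℚ))

sumℚ-neg : ∀ {k} (f : Fin k → ℚ) → sumℚ (λ i → - f i) ≡ - sumℚ f
sumℚ-neg f =
  trans (sumℚ-cong (λ i → sym (-1*x≡-x (f i)))) (trans (sumℚ-*ˡ (- 1ℚ) f) (-1*x≡-x (sumℚ f)))

indicator : ∀ {a} {A : Set a} → Dec A → ℚ
indicator (yes _) = 1ℚ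
indicator (no  _) = 0ℚ

indicator-yes : ∀ {a} {A : Set a} (a? : Dec A) → A → indicator a? ≡ 1ℚ
indicator-yes (yes _) _ = refl
indicator-yes (no ¬a) a = ⊥-elim (¬a a)

indicator-no : ∀ {a} {A : Set a} (a? : Dec A) → ¬ A → indicator a? ≡ 0ℚ
indicator-no (yes a) ¬a = ⊥-elim (¬a a)
indicator-no (no  _) _  = refl

indicator-cong : ∀ {a b} {A : Set a} {B : Set b} (a? : Dec A) (b? : Dec B) →
                 (A → B) → (B → A) → indicator a? ≡ indicator b?
indicator-cong a? (yes b) _   B→A = indicator-yes a? (B→A b)
indicator-cong a? (no ¬b) A→B _   = indicator-no a? (λ a → ¬b (A→B a))

∃-uniform-scale<1 : ∀ {k} (x : Fin k → ℚ) → ∃ λ ε → 0ℚ < ε × (∀ b → 0ℚ < x b → ε * x b < 1ℚ)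
∃-uniform-scale<1 x = inv M , inv-pos M 0<M , ε*x<1
  where
  S = sumℚ (λ b → ∣ x b ∣)
  M = 1ℚ + S
  S<M : S < M
  S<M = subst (_< M) (ℚₚ.+-identityˡ S) (ℚₚ.+-mono-<-≤ (ℚₚ.positive⁻¹ 1ℚ) (ℚₚ.≤-refl {S}))
  0<M : 0ℚ < M
  0<M = ℚₚ.≤-<-trans (sumℚ-nonNeg (λ b → ∣ x b ∣) (λ b → ℚₚ.0≤∣p∣ (x b))) S<M
  ε*x<1 : ∀ b → 0ℚ < x b → inv M * x b < 1ℚ
  ε*x<1 b 0<xb = begin-strict
    inv M * x b   <⟨ ℚₚ.*-monoʳ-<-pos (inv M) {{ℚ.positive (inv-pos M 0<M)}} xb<M ⟩
    inv M * M     ≡⟨ inv-inverseˡ M (λ M≡0 → ℚₚ.<⇒≢ 0<M (sym M≡0)) ⟩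
    1ℚ            ∎
    where
    open ℚₚ.≤-Reasoning
    xb<M : x b < M
    xb<M = ℚₚ.≤-<-trans (ℚₚ.≤-trans (ℚₚ.≤-reflexive (sym (ℚₚ.0≤p⇒∣p∣≡p (ℚₚ.<⇒≤ 0<xb))))
                                    (term≤sumℚ (λ b → ∣ x b ∣) (λ b → ℚₚ.0≤∣p∣ (x b)) b)) S<M

lookup-ext : ∀ {n} {u w : V n} → (∀ k → lookup u k ≡ lookup w k) → u ≡ w
lookup-ext {u = u} {w} u≗w =
  trans (sym (Vecₚ.tabulate∘lookup u)) (trans (Vecₚ.tabulate-cong u≗w) (Vecₚ.tabulate∘lookup w))

lookup-⊕ : ∀ {n} (u w : V n) k → lookup (u ⊕ w) k ≡ lookup u k + lookup w k
lookup-⊕ u w k = Vecₚ.lookup-zipWith _+_ k u w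

lookup-· : ∀ {n} (c : ℚ) (u : V n) k → lookup (c · u) k ≡ c * lookup u k
lookup-· c u k = Vecₚ.lookup-map k (c *_) u

lookup-0v : ∀ {n} k → lookup (0v {n}) k ≡ 0ℚ
lookup-0v k = Vecₚ.lookup-replicate k 0ℚ

lookup-linComb : ∀ {n m} (c : Fin m → ℚ) (v : Fin m → V n) k →
                 lookup (linComb c v) k ≡ sumℚ (λ i → c i * lookup (v i) k)
lookup-linComb {m = zero}  c v k = lookup-0v k
lookup-linComb {m = suc m} c v k =
  trans (lookup-⊕ (c Fin.zero · v Fin.zero) (linComb (λ i → c (Fin.suc i)) (λ i → v (Fin.suc i))) k)
        (cong₂ _+_ (lookup-· (c Fin.zero) (v Fin.zero) k)
                   (lookup-linComb (λ i → c (Fin.suc i)) (λ i → v (Fin.suc i)) k))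

module _ {n m : ℕ} where

  linComb-cong : ∀ {c d : Fin m → ℚ} (v : Fin m → V n) → (∀ i → c i ≡ d i) →
                 linComb c v ≡ linComb d v
  linComb-cong {c} {d} v c≗d = lookup-ext λ k →
    trans (lookup-linComb c v k)
          (trans (sumℚ-cong (λ i → cong (_* lookup (v i) k) (c≗d i))) (sym (lookup-linComb d v k)))

  linComb-zero : ∀ (c : Fin m → ℚ) (v : Fin m → V n) → (∀ i → c i ≡ 0ℚ) → linComb c v ≡ 0v
  linComb-zero c v c≗0 = lookup-ext λ k →
    trans (lookup-linComb c v k)
          (trans (sumℚ-zero (λ i → c i * lookup (v i) k) (term≡0 k)) (sym (lookup-0v k)))
    where
    term≡0 : ∀ k i → c i * lookup (v i) k ≡ 0ℚ
    term≡0 k i = trans (cong (_* lookup (v i) k) (c≗0 i)) (ℚₚ.*-zeroˡ (lookup (v i) k))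

  linComb-δ : ∀ t (v : Fin m → V n) → linComb (δ t) v ≡ v t
  linComb-δ t v = lookup-ext λ k →
    trans (lookup-linComb (δ t) v k) (sumℚ-δ t (λ i → lookup (v i) k))

  linComb-+* : ∀ (c : Fin m → ℚ) r d (v : Fin m → V n) →
               linComb (λ i → c i + r * d i) v ≡ linComb c v ⊕ r · linComb d v
  linComb-+* c r d v = lookup-ext λ k → begin
    lookup (linComb (λ i → c i + r * d i) v) k
      ≡⟨ lookup-linComb (λ i → c i + r * d i) v k ⟩
    sumℚ (λ i → (c i + r * d i) * lookup (v i) k)
      ≡⟨ sumℚ-cong (λ i → solve 4 (λ a r b x → (a :+ r :* b) :* x := a :* x :+ r :* (b :* x))
                                    refl (c i) r (d i) (lookup (v i) k)) ⟩
    sumℚ (λ i → c i * lookup (v i) k + r * (d i * lookup (v i) k))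
      ≡⟨ sumℚ-+ (λ i → c i * lookup (v i) k) (λ i → r * (d i * lookup (v i) k)) ⟩
    sumℚ (λ i → c i * lookup (v i) k) + sumℚ (λ i → r * (d i * lookup (v i) k))
      ≡⟨ cong₂ _+_ (sym (lookup-linComb c v k))
                   (trans (sumℚ-*ˡ r (λ i → d i * lookup (v i) k)) (cong (r *_) (sym (lookup-linComb d v k)))) ⟩
    lookup (linComb c v) k + r * lookup (linComb d v) k
      ≡⟨ cong (lookup (linComb c v) k +_) (sym (lookup-· r (linComb d v) k)) ⟩
    lookup (linComb c v) k + lookup (r · linComb d v) k
      ≡⟨ sym (lookup-⊕ (linComb c v) (r · linComb d v) k) ⟩
    lookup (linComb c v ⊕ r · linComb d v) k ∎
    where open ≡-Reasoning

  linComb-· : ∀ r (c : Fin m → ℚ) (v : Fin m → V n) →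
              r · linComb c v ≡ linComb (λ i → r * c i) v
  linComb-· r c v = lookup-ext λ k → begin
    lookup (r · linComb c v) k                ≡⟨ lookup-· r (linComb c v) k ⟩
    r * lookup (linComb c v) k                ≡⟨ cong (r *_) (lookup-linComb c v k) ⟩
    r * sumℚ (λ i → c i * lookup (v i) k)     ≡⟨ sym (sumℚ-*ˡ r (λ i → c i * lookup (v i) k)) ⟩
    sumℚ (λ i → r * (c i * lookup (v i) k))   ≡⟨ sumℚ-cong (λ i → sym (ℚₚ.*-assoc r (c i) (lookup (v i) k))) ⟩
    sumℚ (λ i → (r * c i) * lookup (v i) k)   ≡⟨ sym (lookup-linComb (λ i → r * c i) v k) ⟩
    lookup (linComb (λ i → r * c i) v) k      ∎
    where open ≡-Reasoning

·-identityˡ : ∀ {n} (v : V n) → 1ℚ · v ≡ v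
·-identityˡ v = lookup-ext λ k → trans (lookup-· 1ℚ v k) (ℚₚ.*-identityˡ (lookup v k))

-1·-involutive : ∀ {n} (v : V n) → (- 1ℚ) · ((- 1ℚ) · v) ≡ v
-1·-involutive v = lookup-ext λ k →
  trans (lookup-· (- 1ℚ) ((- 1ℚ) · v) k)
        (trans (cong ((- 1ℚ) *_) (lookup-· (- 1ℚ) v k))
               (solve 1 (λ x → con (- 1ℚ) :* (con (- 1ℚ) :* x) := x) refl (lookup v k)))

⊕-inverseʳ : ∀ {n} (v : V n) → v ⊕ (- 1ℚ) · v ≡ 0v
⊕-inverseʳ v = lookup-ext λ k → begin
  lookup (v ⊕ (- 1ℚ) · v) k             ≡⟨ lookup-⊕ v ((- 1ℚ) · v) k ⟩
  lookup v k + lookup ((- 1ℚ) · v) k    ≡⟨ cong (lookup v k +_) (lookup-· (- 1ℚ) v k) ⟩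
  lookup v k + (- 1ℚ) * lookup v k      ≡⟨ solve 1 (λ x → x :+ con (- 1ℚ) :* x := con 0ℚ) refl (lookup v k) ⟩
  0ℚ                                    ≡⟨ sym (lookup-0v k) ⟩
  lookup 0v k                           ∎
  where open ≡-Reasoning

-- Reflections

module Euclidean {n : ℕ} (ip : InnerProduct n) where
  open InnerProduct ip

  s : V n → V n → V n
  s = reflection ip

  corootScale : V n → ℚ
  corootScale a = ℤ→ℚ (ℤ.+ 2) * inv ⟪ a , a ⟫

  ⟪0v⟫ˡ : ∀ w → ⟪ 0v , w ⟫ ≡ 0ℚ
  ⟪0v⟫ˡ w = begin
    ⟪ 0v , w ⟫       ≡⟨ cong (λ z → ⟪ z , w ⟫) (lookup-ext λ k → trans (lookup-0v k) (sym (0·0v k))) ⟩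
    ⟪ 0ℚ · 0v , w ⟫  ≡⟨ homog 0ℚ 0v w ⟩
    0ℚ * ⟪ 0v , w ⟫  ≡⟨ ℚₚ.*-zeroˡ ⟪ 0v , w ⟫ ⟩
    0ℚ               ∎
    where
    open ≡-Reasoning
    0·0v : ∀ k → lookup (0ℚ · 0v {n}) k ≡ 0ℚ
    0·0v k = trans (lookup-· 0ℚ 0v k) (ℚₚ.*-zeroˡ (lookup (0v {n}) k))

  ⟪·⟫ʳ : ∀ c u w → ⟪ u , c · w ⟫ ≡ c * ⟪ u , w ⟫
  ⟪·⟫ʳ c u w = trans (symm u (c · w)) (trans (homog c w u) (cong (c *_) (symm w u)))

  ⟪linComb⟫ˡ : ∀ {m} (c : Fin m → ℚ) (v : Fin m → V n) w →
               ⟪ linComb c v , w ⟫ ≡ sumℚ (λ i → c i * ⟪ v i , w ⟫)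
  ⟪linComb⟫ˡ {zero}  c v w = ⟪0v⟫ˡ w
  ⟪linComb⟫ˡ {suc m} c v w =
    trans (additive (c Fin.zero · v Fin.zero) _ w)
          (cong₂ _+_ (homog (c Fin.zero) (v Fin.zero) w) (⟪linComb⟫ˡ (λ i → c (Fin.suc i)) (λ i → v (Fin.suc i)) w))

  ⟪linComb⟫ʳ : ∀ {m} (c : Fin m → ℚ) (v : Fin m → V n) w →
               ⟪ w , linComb c v ⟫ ≡ sumℚ (λ i → c i * ⟪ w , v i ⟫)
  ⟪linComb⟫ʳ c v w =
    trans (symm w _) (trans (⟪linComb⟫ˡ c v w) (sumℚ-cong (λ i → cong (c i *_) (symm (v i) w))))

  ⟪coroot⟫ʳ : ∀ v a → ⟪ v , coroot ip a ⟫ ≡ corootScale a * ⟪ v , a ⟫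
  ⟪coroot⟫ʳ v a = ⟪·⟫ʳ (corootScale a) v a

  corootScale*norm : ∀ a → a ≢ 0v → corootScale a * ⟪ a , a ⟫ ≡ ℤ→ℚ (ℤ.+ 2)
  corootScale*norm a a≢0 =
    trans (ℚₚ.*-assoc (ℤ→ℚ (ℤ.+ 2)) (inv ⟪ a , a ⟫) ⟪ a , a ⟫)
          (trans (cong (ℤ→ℚ (ℤ.+ 2) *_) (inv-inverseˡ _ (λ aa≡0 → ℚₚ.<⇒≢ (posdef a a≢0) (sym aa≡0))))
                 (ℚₚ.*-identityʳ (ℤ→ℚ (ℤ.+ 2))))

  corootScale-pos : ∀ a → a ≢ 0v → 0ℚ < corootScale a
  corootScale-pos a a≢0 = *-pos (ℚₚ.positive⁻¹ (ℤ→ℚ (ℤ.+ 2))) (inv-pos _ (posdef a a≢0))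

  lookup-s : ∀ a x k → lookup (s a x) k ≡ lookup x k + (- (corootScale a * ⟪ x , a ⟫)) * lookup a k
  lookup-s a x k =
    trans (lookup-⊕ x _ k)
          (cong (lookup x k +_) (trans (lookup-· (- ⟪ x , coroot ip a ⟫) a k)
                                       (cong (λ z → (- z) * lookup a k) (⟪coroot⟫ʳ x a))))

  ⟪s⟫ˡ : ∀ a x y → ⟪ s a x , y ⟫ ≡ ⟪ x , y ⟫ + (- (corootScale a * ⟪ x , a ⟫)) * ⟪ a , y ⟫
  ⟪s⟫ˡ a x y =
    trans (additive x _ y)
          (cong (⟪ x , y ⟫ +_) (trans (homog (- ⟪ x , coroot ip a ⟫) a y)
                                      (cong (λ z → (- z) * ⟪ a , y ⟫) (⟪coroot⟫ʳ x a))))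

  s-selfAdjoint : ∀ a x y → ⟪ s a x , y ⟫ ≡ ⟪ x , s a y ⟫
  s-selfAdjoint a x y = begin
    ⟪ s a x , y ⟫                            ≡⟨ ⟪s⟫ˡ a x y ⟩
    ⟪ x , y ⟫ + (- (c * ⟪ x , a ⟫)) * ⟪ a , y ⟫
      ≡⟨ cong₂ (λ p q → p + (- (c * ⟪ x , a ⟫)) * q) (symm x y) (symm a y) ⟩
    ⟪ y , x ⟫ + (- (c * ⟪ x , a ⟫)) * ⟪ y , a ⟫
      ≡⟨ solve 4 (λ yx c xa ya → yx :+ (:- (c :* xa)) :* ya := yx :+ (:- (c :* ya)) :* xa)
               refl ⟪ y , x ⟫ c ⟪ x , a ⟫ ⟪ y , a ⟫ ⟩
    ⟪ y , x ⟫ + (- (c * ⟪ y , a ⟫)) * ⟪ x , a ⟫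
      ≡⟨ cong (λ z → ⟪ y , x ⟫ + (- (c * ⟪ y , a ⟫)) * z) (symm x a) ⟩
    ⟪ y , x ⟫ + (- (c * ⟪ y , a ⟫)) * ⟪ a , x ⟫ ≡⟨ sym (⟪s⟫ˡ a y x) ⟩
    ⟪ s a y , x ⟫                            ≡⟨ symm _ x ⟩
    ⟪ x , s a y ⟫                            ∎
    where
    open ≡-Reasoning
    c = corootScale a

  ⟪s-self⟫ˡ : ∀ a x → a ≢ 0v → ⟪ s a x , a ⟫ ≡ - ⟪ x , a ⟫
  ⟪s-self⟫ˡ a x a≢0 = begin
    ⟪ s a x , a ⟫                                 ≡⟨ ⟪s⟫ˡ a x a ⟩
    ⟪ x , a ⟫ + (- (c * ⟪ x , a ⟫)) * ⟪ a , a ⟫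
      ≡⟨ solve 3 (λ xa c aa → xa :+ (:- (c :* xa)) :* aa := xa :- xa :* (c :* aa)) refl ⟪ x , a ⟫ c ⟪ a , a ⟫ ⟩
    ⟪ x , a ⟫ - ⟪ x , a ⟫ * (c * ⟪ a , a ⟫)
      ≡⟨ cong (λ z → ⟪ x , a ⟫ - ⟪ x , a ⟫ * z) (corootScale*norm a a≢0) ⟩
    ⟪ x , a ⟫ - ⟪ x , a ⟫ * ℤ→ℚ (ℤ.+ 2)
      ≡⟨ solve 1 (λ x → x :- x :* con (ℤ→ℚ (ℤ.+ 2)) := :- x) refl ⟪ x , a ⟫ ⟩
    - ⟪ x , a ⟫                                   ∎
    where
    open ≡-Reasoning
    c = corootScale a

  s-self : ∀ a → a ≢ 0v → s a a ≡ (- 1ℚ) · a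
  s-self a a≢0 = lookup-ext λ k → begin
    lookup (s a a) k                                     ≡⟨ lookup-s a a k ⟩
    lookup a k + (- (corootScale a * ⟪ a , a ⟫)) * lookup a k
      ≡⟨ cong (λ z → lookup a k + (- z) * lookup a k) (corootScale*norm a a≢0) ⟩
    lookup a k + (- ℤ→ℚ (ℤ.+ 2)) * lookup a k
      ≡⟨ solve 1 (λ x → x :+ (:- con (ℤ→ℚ (ℤ.+ 2))) :* x := con (- 1ℚ) :* x) refl (lookup a k) ⟩
    (- 1ℚ) * lookup a k                                  ≡⟨ sym (lookup-· (- 1ℚ) a k) ⟩
    lookup ((- 1ℚ) · a) k                                ∎
    where open ≡-Reasoning

  s-involutive : ∀ a x → a ≢ 0v → s a (s a x) ≡ x
  s-involutive a x a≢0 = lookup-ext λ k → begin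
    lookup (s a (s a x)) k                               ≡⟨ lookup-s a (s a x) k ⟩
    lookup (s a x) k + (- (c * ⟪ s a x , a ⟫)) * lookup a k
      ≡⟨ cong₂ (λ p q → p + (- (c * q)) * lookup a k) (lookup-s a x k) (⟪s-self⟫ˡ a x a≢0) ⟩
    (lookup x k + (- (c * ⟪ x , a ⟫)) * lookup a k) + (- (c * - ⟪ x , a ⟫)) * lookup a k
      ≡⟨ solve 4 (λ xk c xa ak → (xk :+ (:- (c :* xa)) :* ak) :+ (:- (c :* (:- xa))) :* ak := xk)
               refl (lookup x k) c ⟪ x , a ⟫ (lookup a k) ⟩
    lookup x k                                           ∎
    where
    open ≡-Reasoning
    c = corootScale a

  s-isometry : ∀ a b → a ≢ 0v → ⟪ s a b , s a b ⟫ ≡ ⟪ b , b ⟫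
  s-isometry a b a≢0 = trans (s-selfAdjoint a b (s a b)) (cong (λ z → ⟪ b , z ⟫) (s-involutive a b a≢0))

  ⟪s,coroot-self⟫ : ∀ a v → a ≢ 0v → ⟪ s a v , coroot ip a ⟫ ≡ - ⟪ v , coroot ip a ⟫
  ⟪s,coroot-self⟫ a v a≢0 = begin
    ⟪ s a v , coroot ip a ⟫          ≡⟨ ⟪coroot⟫ʳ (s a v) a ⟩
    corootScale a * ⟪ s a v , a ⟫    ≡⟨ cong (corootScale a *_) (⟪s-self⟫ˡ a v a≢0) ⟩
    corootScale a * - ⟪ v , a ⟫      ≡⟨ sym (ℚₚ.neg-distribʳ-* (corootScale a) ⟪ v , a ⟫) ⟩
    - (corootScale a * ⟪ v , a ⟫)    ≡⟨ cong -_ (sym (⟪coroot⟫ʳ v a)) ⟩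
    - ⟪ v , coroot ip a ⟫            ∎
    where open ≡-Reasoning

  corootScale-s : ∀ a b → a ≢ 0v → corootScale (s a b) ≡ corootScale b
  corootScale-s a b a≢0 = cong (λ z → ℤ→ℚ (ℤ.+ 2) * inv z) (s-isometry a b a≢0)

  ⟪s,coroot⟫ : ∀ a v b → a ≢ 0v → ⟪ s a v , coroot ip b ⟫ ≡ ⟪ v , coroot ip (s a b) ⟫
  ⟪s,coroot⟫ a v b a≢0 = begin
    ⟪ s a v , coroot ip b ⟫              ≡⟨ ⟪coroot⟫ʳ (s a v) b ⟩
    corootScale b * ⟪ s a v , b ⟫        ≡⟨ cong₂ _*_ (sym (corootScale-s a b a≢0)) (s-selfAdjoint a v b) ⟩
    corootScale (s a b) * ⟪ v , s a b ⟫  ≡⟨ sym (⟪coroot⟫ʳ v (s a b)) ⟩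
    ⟪ v , coroot ip (s a b) ⟫            ∎
    where open ≡-Reasoning

  coroot-s : ∀ a b → a ≢ 0v → coroot ip (s a b) ≡ coroot ip b ⊕ (- (corootScale b * ⟪ b , a ⟫)) · coroot ip a
  coroot-s a b a≢0 = lookup-ext λ m → begin
    lookup (coroot ip (s a b)) m
      ≡⟨ lookup-· (corootScale (s a b)) (s a b) m ⟩
    corootScale (s a b) * lookup (s a b) m
      ≡⟨ cong₂ _*_ (corootScale-s a b a≢0) (lookup-s a b m) ⟩
    cb * (lookup b m + (- (ca * ⟪ b , a ⟫)) * lookup a m)
      ≡⟨ solve 5 (λ cb bm ca ba am → cb :* (bm :+ (:- (ca :* ba)) :* am) := cb :* bm :+ (:- (cb :* ba)) :* (ca :* am))
               refl cb (lookup b m) ca ⟪ b , a ⟫ (lookup a m) ⟩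
    cb * lookup b m + (- (cb * ⟪ b , a ⟫)) * (ca * lookup a m)
      ≡⟨ sym (cong₂ (λ x y → x + (- (cb * ⟪ b , a ⟫)) * y) (lookup-· cb b m) (lookup-· ca a m)) ⟩
    lookup (coroot ip b) m + (- (cb * ⟪ b , a ⟫)) * lookup (coroot ip a) m
      ≡⟨ cong (lookup (coroot ip b) m +_) (sym (lookup-· r (coroot ip a) m)) ⟩
    lookup (coroot ip b) m + lookup (r · coroot ip a) m
      ≡⟨ sym (lookup-⊕ (coroot ip b) (r · coroot ip a) m) ⟩
    lookup (coroot ip b ⊕ (- (cb * ⟪ b , a ⟫)) · coroot ip a) m ∎
    where
    open ≡-Reasoning
    ca = corootScale a
    cb = corootScale b
    r = - (cb * ⟪ b , a ⟫)

-- Coordinates with respect to a base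

module SimpleRoots {n : ℕ} {ip : InnerProduct n} {R : RootSystem ip} (Δ : Base R) where
  open InnerProduct ip
  open RootSystem R
  open Base Δ
  open Euclidean ip

  α : Fin n → V n
  α = αs Δ

  Σα : (Fin n → ℚ) → V n
  Σα c = linComb c α

  Pos : Fin N → Set
  Pos = Positive Δ

  α≢0 : ∀ t → α t ≢ 0v
  α≢0 t = nonzero (simple t)

  Σα-injective : ∀ c d → Σα c ≡ Σα d → ∀ t → c t ≡ d t
  Σα-injective c d c≡d t = x-y≡0⇒x≡y (c t) (d t) (independent (λ i → c i + (- 1ℚ) * d i) Σα[c-d]≡0 t)
    where
    Σα[c-d]≡0 : Σα (λ i → c i + (- 1ℚ) * d i) ≡ 0v
    Σα[c-d]≡0 = trans (linComb-+* c (- 1ℚ) d α) (trans (cong (_⊕ (- 1ℚ) · Σα d) c≡d) (⊕-inverseʳ (Σα d)))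

  α≡Σαδ : ∀ t → α t ≡ Σα (δ t)
  α≡Σαδ t = sym (linComb-δ t α)

  α-injective : ∀ s t → α s ≡ α t → s ≡ t
  α-injective s t αs≡αt with s Fin.≟ t
  ... | yes s≡t = s≡t
  ... | no  s≢t = ⊥-elim (0≢1 (trans (sym (δ-off s t s≢t))
                                     (trans (Σα-injective (δ s) (δ t) δs≡δt t) (δ-diag t))))
    where
    δs≡δt : Σα (δ s) ≡ Σα (δ t)
    δs≡δt = trans (sym (α≡Σαδ s)) (trans αs≡αt (α≡Σαδ t))

  simple-positive : ∀ t → Pos (simple t)
  simple-positive t = δℤ t , α≡Σαδ t , δℤ-nonNeg t

  reflCoeff : Fin n → V n → ℚ
  reflCoeff t v = - (corootScale (α t) * ⟪ v , α t ⟫)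

  s-Σα : ∀ t c → s (α t) (Σα c) ≡ Σα (λ i → c i + reflCoeff t (Σα c) * δ t i)
  s-Σα t c = begin
    s (α t) (Σα c)                            ≡⟨ cong (λ r → Σα c ⊕ (- r) · α t) (⟪coroot⟫ʳ (Σα c) (α t)) ⟩
    Σα c ⊕ reflCoeff t (Σα c) · α t           ≡⟨ cong (λ v → Σα c ⊕ reflCoeff t (Σα c) · v) (α≡Σαδ t) ⟩
    Σα c ⊕ reflCoeff t (Σα c) · Σα (δ t)      ≡⟨ sym (linComb-+* c (reflCoeff t (Σα c)) (δ t) α) ⟩
    Σα (λ i → c i + reflCoeff t (Σα c) * δ t i) ∎
    where open ≡-Reasoning

  σ : Fin n → Fin N → Fin N
  σ t b = proj₁ (refl-closed (simple t) b)

  σ-root : ∀ t b → root (σ t b) ≡ s (α t) (root b)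
  σ-root t b = proj₂ (refl-closed (simple t) b)

  σ-involutive : ∀ t b → σ t (σ t b) ≡ b
  σ-involutive t b = root-inj _ _ (begin
    root (σ t (σ t b))         ≡⟨ σ-root t (σ t b) ⟩
    s (α t) (root (σ t b))     ≡⟨ cong (s (α t)) (σ-root t b) ⟩
    s (α t) (s (α t) (root b)) ≡⟨ s-involutive (α t) (root b) (α≢0 t) ⟩
    root b                     ∎)
    where open ≡-Reasoning

  Σα-concentrated : ∀ t c → (∀ i → i ≢ t → c i ≡ 0ℚ) → Σα c ≡ c t · α t
  Σα-concentrated t c c≗0 = begin
    Σα c                      ≡⟨ linComb-cong α c≡ct·δt ⟩
    Σα (λ i → c t * δ t i)    ≡⟨ sym (linComb-· (c t) (δ t) α) ⟩
    c t · Σα (δ t)            ≡⟨ cong (c t ·_) (sym (α≡Σαδ t)) ⟩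
    c t · α t                 ∎
    where
    open ≡-Reasoning
    c≡ct·δt : ∀ i → c i ≡ c t * δ t i
    c≡ct·δt i with i Fin.≟ t
    ... | yes refl = sym (trans (cong (c i *_) (δ-diag i)) (ℚₚ.*-identityʳ (c i)))
    ... | no  i≢t  = trans (c≗0 i i≢t)
                           (sym (trans (cong (c t *_) (δ-off t i (λ t≡i → i≢t (sym t≡i)))) (ℚₚ.*-zeroʳ (c t))))

  nonNeg-multiple-of-simple : ∀ t b r → root b ≡ r · α t → 0ℚ ≤ r → root b ≡ α t
  nonNeg-multiple-of-simple t b r b≡r·αt 0≤r with reduced (simple t) b r b≡r·αt
  ... | inj₁ r≡1  = trans b≡r·αt (trans (cong (_· α t) r≡1) (·-identityˡ (α t)))
  ... | inj₂ r≡-1 = ⊥-elim (0≰-1 (subst (0ℚ ≤_) r≡-1 0≤r))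

  ∃-pos-coord-off : ∀ t b c → root b ≡ Σα c → (∀ i → 0ℚ ≤ c i) → root b ≢ α t →
                       ∃ λ u → u ≢ t × 0ℚ < c u
  ∃-pos-coord-off t b c b≡Σαc 0≤c b≢αt with Finₚ.any? (λ u → ¬? (u Fin.≟ t) ×-dec (0ℚ ℚₚ.<? c u))
  ... | yes found = found
  ... | no  none  = ⊥-elim (b≢αt (nonNeg-multiple-of-simple t b (c t) b≡ct·αt (0≤c t)))
    where
    b≡ct·αt : root b ≡ c t · α t
    b≡ct·αt = trans b≡Σαc (Σα-concentrated t c λ i i≢t →
                ℚₚ.≤-antisym (ℚₚ.≮⇒≥ (λ 0<ci → none (i , i≢t , 0<ci))) (0≤c i))

  σ-coords : ∀ t b c → root b ≡ Σα c → root (σ t b) ≡ Σα (λ i → c i + reflCoeff t (Σα c) * δ t i)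
  σ-coords t b c b≡Σαc = trans (σ-root t b) (trans (cong (s (α t)) b≡Σαc) (s-Σα t c))

  σ-coords-off : ∀ t b c c′ → root b ≡ Σα c → root (σ t b) ≡ Σα c′ → ∀ u → u ≢ t → c′ u ≡ c u
  σ-coords-off t b c c′ b≡Σαc σb≡Σαc′ u u≢t =
    trans (sym (Σα-injective _ c′ (trans (sym (σ-coords t b c b≡Σαc)) σb≡Σαc′) u))
          (+*δ-off t u (c u) (reflCoeff t (Σα c)) (λ t≡u → u≢t (sym t≡u)))

  σ-positive : ∀ t b → Pos b → root b ≢ α t → Pos (σ t b)
  σ-positive t b (z , b≡Σαz , 0≤z) b≢αt with signed (σ t b)
  ... | z′ , σb≡Σαz′ , inj₁ 0≤z′ = z′ , σb≡Σαz′ , 0≤z′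
  ... | z′ , σb≡Σαz′ , inj₂ z′≤0
    with ∃-pos-coord-off t b (λ i → ℤ→ℚ (z i)) b≡Σαz (λ i → ℤ→ℚ-mono-≤ (0≤z i)) b≢αt
  ...   | u , u≢t , 0<zu = ⊥-elim (ℚₚ.<-irrefl refl (ℚₚ.<-≤-trans 0<zu (begin
    ℤ→ℚ (z u)   ≡⟨ sym (σ-coords-off t b _ _ b≡Σαz σb≡Σαz′ u u≢t) ⟩
    ℤ→ℚ (z′ u)  ≤⟨ ℤ→ℚ-mono-≤ (z′≤0 u) ⟩
    0ℚ          ∎)))
    where open ℚₚ.≤-Reasoning

  ∃-⟪α⟫-pos : ∀ c → (∀ i → 0ℚ ≤ c i) → Σα c ≢ 0v → ∃ λ t → 0ℚ < ⟪ Σα c , α t ⟫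
  ∃-⟪α⟫-pos c 0≤c Σαc≢0 with Finₚ.any? (λ t → 0ℚ ℚₚ.<? ⟪ Σα c , α t ⟫)
  ... | yes found = found
  ... | no  none  = ⊥-elim (ℚₚ.<-irrefl refl (ℚₚ.<-≤-trans (posdef (Σα c) Σαc≢0) (begin
    ⟪ Σα c , Σα c ⟫                    ≡⟨ ⟪linComb⟫ʳ c α (Σα c) ⟩
    sumℚ (λ i → c i * ⟪ Σα c , α i ⟫)  ≤⟨ sumℚ-nonPos _ (λ i → *-nonNeg-nonPos (0≤c i) (⟪Σαc,αi⟫≤0 i)) ⟩
    0ℚ                                 ∎)))
    where
    open ℚₚ.≤-Reasoning
    ⟪Σαc,αi⟫≤0 : ∀ i → ⟪ Σα c , α i ⟫ ≤ 0ℚ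
    ⟪Σαc,αi⟫≤0 i = ℚₚ.≮⇒≥ (λ 0<⟪Σαc,αi⟫ → none (i , 0<⟪Σαc,αi⟫))

  negRoot : Fin N → Fin N
  negRoot b = proj₁ (refl-closed b b)

  negRoot-root : ∀ b → root (negRoot b) ≡ (- 1ℚ) · root b
  negRoot-root b = trans (proj₂ (refl-closed b b)) (s-self (root b) (nonzero b))

  negRoot-coords : ∀ b (z : Fin n → ℤ) → root b ≡ Σα (λ i → ℤ→ℚ (z i)) →
                   root (negRoot b) ≡ Σα (λ i → ℤ→ℚ (ℤ.- z i))
  negRoot-coords b z b≡Σαz = begin
    root (negRoot b)                        ≡⟨ negRoot-root b ⟩
    (- 1ℚ) · root b                         ≡⟨ cong ((- 1ℚ) ·_) b≡Σαz ⟩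
    (- 1ℚ) · Σα (λ i → ℤ→ℚ (z i))           ≡⟨ linComb-· (- 1ℚ) (λ i → ℤ→ℚ (z i)) α ⟩
    Σα (λ i → (- 1ℚ) * ℤ→ℚ (z i))
      ≡⟨ linComb-cong α (λ i → trans (-1*x≡-x _) (sym (ℤ→ℚ-neg (z i)))) ⟩
    Σα (λ i → ℤ→ℚ (ℤ.- z i))                ∎
    where open ≡-Reasoning

  ⟪σ,α⟫ : ∀ t b → ⟪ root (σ t b) , α t ⟫ ≡ - ⟪ root b , α t ⟫
  ⟪σ,α⟫ t b = trans (cong (λ v → ⟪ v , α t ⟫) (σ-root t b)) (⟪s-self⟫ˡ (α t) (root b) (α≢0 t))

  -- Reflecting a root β with ⟨β, α_t⟩ > 0 lowers its height by the integer ⟨β, α_t^∨⟩ ≥ 1.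
  σ-height : ∀ t b c c′ → root b ≡ Σα c → root (σ t b) ≡ Σα c′ → 0ℚ < ⟪ root b , α t ⟫ →
             sumℚ c′ + 1ℚ ≤ sumℚ c
  σ-height t b c c′ b≡Σαc σb≡Σαc′ 0<⟪b,αt⟫ with integral (simple t) b
  ... | m , ⟨b,αt^∨⟩≡m = begin
    sumℚ c′ + 1ℚ                               ≡⟨ cong (_+ 1ℚ) sumc′ ⟩
    (sumℚ c + - p) + 1ℚ
      ≤⟨ ℚₚ.+-monoˡ-≤ 1ℚ (ℚₚ.+-monoʳ-≤ (sumℚ c) (ℚₚ.neg-antimono-≤ 1≤p)) ⟩
    (sumℚ c + - 1ℚ) + 1ℚ
      ≡⟨ solve 1 (λ x → (x :+ (:- con 1ℚ)) :+ con 1ℚ := x) refl (sumℚ c) ⟩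
    sumℚ c                                     ∎
    where
    open ℚₚ.≤-Reasoning
    p = corootScale (α t) * ⟪ Σα c , α t ⟫
    p≡m : p ≡ ℤ→ℚ m
    p≡m = trans (sym (⟪coroot⟫ʳ (Σα c) (α t)))
                (trans (cong (λ v → ⟪ v , coroot ip (α t) ⟫) (sym b≡Σαc)) ⟨b,αt^∨⟩≡m)
    1≤p : 1ℚ ≤ p
    1≤p = subst (1ℚ ≤_) (sym p≡m) (ℤ→ℚ-pos⇒≥1 m (subst (0ℚ <_) p≡m
            (*-pos (corootScale-pos (α t) (α≢0 t)) (subst (λ v → 0ℚ < ⟪ v , α t ⟫) b≡Σαc 0<⟪b,αt⟫))))
    c′≡ : ∀ i → c′ i ≡ c i + (- p) * δ t i
    c′≡ i = sym (Σα-injective _ c′ (trans (sym (σ-coords t b c b≡Σαc)) σb≡Σαc′) i)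
    sumc′ : sumℚ c′ ≡ sumℚ c + - p
    sumc′ = begin-equality
      sumℚ c′                                  ≡⟨ sumℚ-cong c′≡ ⟩
      sumℚ (λ i → c i + (- p) * δ t i)         ≡⟨ sumℚ-+ c _ ⟩
      sumℚ c + sumℚ (λ i → (- p) * δ t i)      ≡⟨ cong (sumℚ c +_) (sumℚ-*ˡ (- p) (δ t)) ⟩
      sumℚ c + (- p) * sumℚ (δ t)              ≡⟨ cong (λ x → sumℚ c + (- p) * x) (sumℚ-δ-one t) ⟩
      sumℚ c + (- p) * 1ℚ                      ≡⟨ cong (sumℚ c +_) (ℚₚ.*-identityʳ (- p)) ⟩
      sumℚ c + - p                             ∎

-- Connectedness of the Dynkin diagram

module Connectedness {n : ℕ} {ip : InnerProduct n} {R : RootSystem ip} (Δ : Base R) where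
  open InnerProduct ip
  open RootSystem R
  open Base Δ
  open Euclidean ip
  open SimpleRoots Δ

  -- If simple roots of different colours are orthogonal, descent on height puts every root in
  -- the span of a single colour class; irreducibility then leaves room for only one colour.
  module Colouring (T : Fin n → Bool) (orth : ∀ u v → T u ≢ T v → ⟪ α u , α v ⟫ ≡ 0ℚ) where

    InSpan : Bool → V n → Set
    InSpan col v = ∃ λ c → (v ≡ Σα c) × (∀ u → T u ≢ col → c u ≡ 0ℚ)

    InSpan-⟪α⟫ : ∀ {col v} t → InSpan col v → T t ≢ col → ⟪ v , α t ⟫ ≡ 0ℚ
    InSpan-⟪α⟫ {col} t (c , v≡Σαc , c≗0) Tt≢col =
      trans (cong (λ w → ⟪ w , α t ⟫) v≡Σαc)
            (trans (⟪linComb⟫ˡ c α (α t)) (sumℚ-zero (λ u → c u * ⟪ α u , α t ⟫) term≡0))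
      where
      term≡0 : ∀ u → c u * ⟪ α u , α t ⟫ ≡ 0ℚ
      term≡0 u with T u Boolₚ.≟ col
      ... | yes Tu≡col = trans (cong (c u *_) (orth u t (λ Tu≡Tt → Tt≢col (trans (sym Tu≡Tt) Tu≡col))))
                               (ℚₚ.*-zeroʳ (c u))
      ... | no  Tu≢col = trans (cong (_* ⟪ α u , α t ⟫) (c≗0 u Tu≢col)) (ℚₚ.*-zeroˡ ⟪ α u , α t ⟫)

    InSpan-orthogonal : ∀ {col col′ v w} → InSpan col v → InSpan col′ w → col ≢ col′ → ⟪ v , w ⟫ ≡ 0ℚ
    InSpan-orthogonal {col} {w = w} (c , v≡Σαc , c≗0) w∈col′ col≢col′ =
      trans (cong (λ x → ⟪ x , w ⟫) v≡Σαc)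
            (trans (⟪linComb⟫ˡ c α w) (sumℚ-zero (λ u → c u * ⟪ α u , w ⟫) term≡0))
      where
      term≡0 : ∀ u → c u * ⟪ α u , w ⟫ ≡ 0ℚ
      term≡0 u with T u Boolₚ.≟ col
      ... | yes Tu≡col = trans (cong (c u *_) (trans (symm (α u) w)
                                 (InSpan-⟪α⟫ u w∈col′ (λ Tu≡col′ → col≢col′ (trans (sym Tu≡col) Tu≡col′)))))
                               (ℚₚ.*-zeroʳ (c u))
      ... | no  Tu≢col = trans (cong (_* ⟪ α u , w ⟫) (c≗0 u Tu≢col)) (ℚₚ.*-zeroˡ ⟪ α u , w ⟫)

    α-InSpan : ∀ t → InSpan (T t) (α t)
    α-InSpan t = δ t , α≡Σαδ t , λ u Tu≢Tt → δ-off t u (λ t≡u → Tu≢Tt (cong T (sym t≡u)))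

    InSpan-α : ∀ {col} t → InSpan col (α t) → T t ≡ col
    InSpan-α {col} t (c , αt≡Σαc , c≗0) with T t Boolₚ.≟ col
    ... | yes Tt≡col = Tt≡col
    ... | no  Tt≢col = ⊥-elim (1≢0 (begin
      1ℚ     ≡⟨ sym (δ-diag t) ⟩
      δ t t  ≡⟨ Σα-injective (δ t) c (trans (sym (α≡Σαδ t)) αt≡Σαc) t ⟩
      c t    ≡⟨ c≗0 t Tt≢col ⟩
      0ℚ     ∎))
      where open ≡-Reasoning

    InSpan-s : ∀ {col v} t → InSpan col v → T t ≡ col → InSpan col (s (α t) v)
    InSpan-s {col} t (c , v≡Σαc , c≗0) Tt≡col =
      (λ i → c i + reflCoeff t (Σα c) * δ t i) ,
      trans (cong (s (α t)) v≡Σαc) (s-Σα t c) ,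
      λ u Tu≢col → trans (+*δ-off t u (c u) (reflCoeff t (Σα c)) (λ t≡u → Tu≢col (trans (cong T (sym t≡u)) Tt≡col)))
                         (c≗0 u Tu≢col)

    InSpan-neg : ∀ {col v} → InSpan col v → InSpan col ((- 1ℚ) · v)
    InSpan-neg (c , v≡Σαc , c≗0) =
      (λ i → (- 1ℚ) * c i) ,
      trans (cong ((- 1ℚ) ·_) v≡Σαc) (linComb-· (- 1ℚ) c α) ,
      λ u Tu≢col → trans (cong ((- 1ℚ) *_) (c≗0 u Tu≢col)) (ℚₚ.*-zeroʳ (- 1ℚ))

    σ-InSpan⁻¹ : ∀ {col} t b → 0ℚ < ⟪ root b , α t ⟫ → InSpan col (root (σ t b)) → InSpan col (root b)
    σ-InSpan⁻¹ {col} t b 0<⟪b,αt⟫ σb∈col with T t Boolₚ.≟ col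
    ... | yes Tt≡col = subst (InSpan col) b≡sσb (InSpan-s t σb∈col Tt≡col)
      where
      b≡sσb : s (α t) (root (σ t b)) ≡ root b
      b≡sσb = trans (sym (σ-root t (σ t b))) (cong root (σ-involutive t b))
    ... | no  Tt≢col = ⊥-elim (ℚₚ.<-irrefl refl (subst (0ℚ <_) ⟪b,αt⟫≡0 0<⟪b,αt⟫))
      where
      ⟪b,αt⟫≡0 : ⟪ root b , α t ⟫ ≡ 0ℚ
      ⟪b,αt⟫≡0 = begin
        ⟪ root b , α t ⟫             ≡⟨ sym (neg-involutive ⟪ root b , α t ⟫) ⟩
        - (- ⟪ root b , α t ⟫)       ≡⟨ cong -_ (sym (⟪σ,α⟫ t b)) ⟩
        - ⟪ root (σ t b) , α t ⟫     ≡⟨ cong -_ (InSpan-⟪α⟫ t σb∈col Tt≢col) ⟩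
        0ℚ                           ∎
        where open ≡-Reasoning

    positive-InSpan : ∀ h b z → root b ≡ Σα (λ i → ℤ→ℚ (z i)) → (∀ i → ℤ.+ 0 ℤ.≤ z i) →
                      sumℚ (λ i → ℤ→ℚ (z i)) ≤ ℕ→ℚ h → Σ Bool λ col → InSpan col (root b)
    positive-InSpan h b z b≡Σαz 0≤z height≤h
      with ∃-⟪α⟫-pos (λ i → ℤ→ℚ (z i)) (λ i → ℤ→ℚ-mono-≤ (0≤z i))
                     (λ Σαz≡0 → nonzero b (trans b≡Σαz Σαz≡0))
    ... | t , 0<⟪Σαz,αt⟫ with b Fin.≟ simple t
    ...   | yes refl = T t , α-InSpan t
    ...   | no  b≢t with σ-positive t b (z , b≡Σαz , 0≤z) (λ b≡αt → b≢t (root-inj _ _ b≡αt))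
    ...     | z′ , σb≡Σαz′ , 0≤z′ = descend h height≤h
      where
      0<⟪b,αt⟫ : 0ℚ < ⟪ root b , α t ⟫
      0<⟪b,αt⟫ = subst (λ v → 0ℚ < ⟪ v , α t ⟫) (sym b≡Σαz) 0<⟪Σαz,αt⟫
      height′ : ℚ
      height′ = sumℚ (λ i → ℤ→ℚ (z′ i))
      lower : height′ + 1ℚ ≤ sumℚ (λ i → ℤ→ℚ (z i))
      lower = σ-height t b (λ i → ℤ→ℚ (z i)) (λ i → ℤ→ℚ (z′ i)) b≡Σαz σb≡Σαz′ 0<⟪b,αt⟫
      descend : ∀ h → sumℚ (λ i → ℤ→ℚ (z i)) ≤ ℕ→ℚ h → Σ Bool λ col → InSpan col (root b)
      descend zero    height≤0 = ⊥-elim (nonNeg+1≰0 height′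
        (sumℚ-nonNeg (λ i → ℤ→ℚ (z′ i)) (λ i → ℤ→ℚ-mono-≤ (0≤z′ i))) (ℚₚ.≤-trans lower height≤0))
      descend (suc h) height≤h+1 = map₂ (σ-InSpan⁻¹ t b 0<⟪b,αt⟫)
        (positive-InSpan h (σ t b) z′ σb≡Σαz′ 0≤z′ (+1≤suc⇒≤ height′ h (ℚₚ.≤-trans lower height≤h+1)))

    nonNeg-InSpan : ∀ b z → root b ≡ Σα (λ i → ℤ→ℚ (z i)) → (∀ i → ℤ.+ 0 ℤ.≤ z i) →
                    Σ Bool λ col → InSpan col (root b)
    nonNeg-InSpan b z b≡Σαz 0≤z = positive-InSpan (proj₁ bound) b z b≡Σαz 0≤z (proj₂ bound)
      where bound = ℕ→ℚ-unbounded (sumℚ (λ i → ℤ→ℚ (z i)))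

    root-InSpan : ∀ b → Σ Bool λ col → InSpan col (root b)
    root-InSpan b with signed b
    ... | z , b≡Σαz , inj₁ 0≤z = nonNeg-InSpan b z b≡Σαz 0≤z
    ... | z , b≡Σαz , inj₂ z≤0 = map₂ from-negRoot
      (nonNeg-InSpan (negRoot b) (λ i → ℤ.- z i) (negRoot-coords b z b≡Σαz) (λ i → ℤₚ.neg-mono-≤ (z≤0 i)))
      where
      from-negRoot : ∀ {col} → InSpan col (root (negRoot b)) → InSpan col (root b)
      from-negRoot {col} -b∈col = subst (InSpan col) (-1·-involutive (root b))
        (subst (λ v → InSpan col ((- 1ℚ) · v)) (negRoot-root b) (InSpan-neg -b∈col))

  colouring-constant : ∀ (T : Fin n → Bool) → (∀ u v → T u ≢ T v → ⟪ α u , α v ⟫ ≡ 0ℚ) →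
                       ∀ u v → T u ≡ T v
  colouring-constant T orth u v = [ constant , constant ]′ (irreducible colour colour-orthogonal)
    where
    open Colouring T orth
    colour : Fin N → Bool
    colour b = proj₁ (root-InSpan b)
    colour-orthogonal : ∀ a b → colour a ≡ true → colour b ≡ false → ⟪ root a , root b ⟫ ≡ 0ℚ
    colour-orthogonal a b a-true b-false =
      InSpan-orthogonal (proj₂ (root-InSpan a)) (proj₂ (root-InSpan b))
                        (λ ca≡cb → true≢false (trans (sym a-true) (trans ca≡cb b-false)))
      where
      true≢false : true ≢ false
      true≢false ()
    T≡colour : ∀ t → T t ≡ colour (simple t)
    T≡colour t = InSpan-α t (proj₂ (root-InSpan (simple t)))
    constant : ∀ {x} → (∀ a → colour a ≡ x) → T u ≡ T v
    constant colour≡x =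
      trans (T≡colour u) (trans (colour≡x (simple u)) (sym (trans (T≡colour v) (colour≡x (simple v)))))

  dynkin-connected : ∀ {p} {P : Fin n → Set p} → Decidable P →
                     (∀ u v → P u → ¬ P v → ⟪ α u , α v ⟫ ≡ 0ℚ) → ∀ u v → P u → P v
  dynkin-connected {P = P} P? orth u v =
    transfer (P? u) (P? v) (colouring-constant (λ x → does (P? x)) (λ x y → orth′ (P? x) (P? y)) u v)
    where
    orth′ : ∀ {x y} (x? : Dec (P x)) (y? : Dec (P y)) → does x? ≢ does y? → ⟪ α x , α y ⟫ ≡ 0ℚ
    orth′ (yes Px) (no ¬Py) _ = orth _ _ Px ¬Py
    orth′ {x} {y} (no ¬Px) (yes Py) _ = trans (symm (α x) (α y)) (orth _ _ Py ¬Px)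
    orth′ (yes _) (yes _) ne = ⊥-elim (ne refl)
    orth′ (no _)  (no _)  ne = ⊥-elim (ne refl)
    transfer : (u? : Dec (P u)) (v? : Dec (P v)) → does u? ≡ does v? → P u → P v
    transfer _       (yes Pv) _  _  = Pv
    transfer (no ¬Pu) (no _)  _  Pu = ⊥-elim (¬Pu Pu)

-- The fundamental alcove and ι(s_i)

module PositiveRootSum {n : ℕ} {ip : InnerProduct n} {R : RootSystem ip} (Δ : Base R) where
  open InnerProduct ip
  open RootSystem R
  open Base Δ
  open Euclidean ip
  open SimpleRoots Δ

  nonPos⇒¬Pos : ∀ b (z : Fin n → ℤ) → root b ≡ Σα (λ i → ℤ→ℚ (z i)) → (∀ i → z i ℤ.≤ ℤ.+ 0) →
                ¬ Pos b
  nonPos⇒¬Pos b z b≡Σαz z≤0 (z′ , b≡Σαz′ , 0≤z′) =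
    nonzero b (trans b≡Σαz′ (linComb-zero (λ i → ℤ→ℚ (z′ i)) α z′≡0))
    where
    z′≡0 : ∀ i → ℤ→ℚ (z′ i) ≡ 0ℚ
    z′≡0 i = ℚₚ.≤-antisym (begin
      ℤ→ℚ (z′ i) ≡⟨ Σα-injective _ (λ i → ℤ→ℚ (z i)) (trans (sym b≡Σαz′) b≡Σαz) i ⟩
      ℤ→ℚ (z i)  ≤⟨ ℤ→ℚ-mono-≤ (z≤0 i) ⟩
      0ℚ         ∎) (ℤ→ℚ-mono-≤ (0≤z′ i))
      where open ℚₚ.≤-Reasoning

  pos? : ∀ b → Dec (Pos b)
  pos? b with signed b
  ... | z , b≡Σαz , inj₁ 0≤z = yes (z , b≡Σαz , 0≤z)
  ... | z , b≡Σαz , inj₂ z≤0 = no (nonPos⇒¬Pos b z b≡Σαz z≤0)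

  ρ : V n
  ρ = linComb (λ b → indicator (pos? b)) root

  ¬Pos-σ-simple : ∀ t → ¬ Pos (σ t (simple t))
  ¬Pos-σ-simple t (z , -αt≡Σαz , 0≤z) = 0≰-1 (subst (0ℚ ≤_) zt≡-1 (ℤ→ℚ-mono-≤ (0≤z t)))
    where
    -αt≡Σα-δt : root (σ t (simple t)) ≡ Σα (λ i → (- 1ℚ) * δ t i)
    -αt≡Σα-δt = trans (σ-root t (simple t))
                  (trans (s-self (α t) (α≢0 t)) (trans (cong ((- 1ℚ) ·_) (α≡Σαδ t)) (linComb-· (- 1ℚ) (δ t) α)))
    zt≡-1 : ℤ→ℚ (z t) ≡ - 1ℚ
    zt≡-1 = trans (Σα-injective _ (λ i → (- 1ℚ) * δ t i) (trans (sym -αt≡Σαz) -αt≡Σα-δt) t)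
                  (trans (cong ((- 1ℚ) *_) (δ-diag t)) (ℚₚ.*-identityʳ (- 1ℚ)))

  PosOff : Fin n → Fin N → Set
  PosOff t b = Pos b × b ≢ simple t

  posOff? : ∀ t b → Dec (PosOff t b)
  posOff? t b = pos? b ×-dec ¬? (b Fin.≟ simple t)

  σ-PosOff : ∀ t b → PosOff t b → PosOff t (σ t b)
  σ-PosOff t b (pos , b≢t) =
    σ-positive t b pos (λ b≡αt → b≢t (root-inj _ _ b≡αt)) ,
    λ σb≡t → ¬Pos-σ-simple t (subst (λ x → Pos (σ t x)) σb≡t (subst Pos (sym (σ-involutive t b)) pos))

  indicator-PosOff-σ : ∀ t b → indicator (posOff? t (σ t b)) ≡ indicator (posOff? t b)
  indicator-PosOff-σ t b = indicator-cong (posOff? t (σ t b)) (posOff? t b)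
    (λ p → subst (PosOff t) (σ-involutive t b) (σ-PosOff t (σ t b) p)) (σ-PosOff t b)

  indicator-Pos : ∀ t b → indicator (pos? b) ≡ indicator (posOff? t b) + δ (simple t) b
  indicator-Pos t b = by-cases (b Fin.≟ simple t)
    where
    open ≡-Reasoning
    by-cases : Dec (b ≡ simple t) → indicator (pos? b) ≡ indicator (posOff? t b) + δ (simple t) b
    by-cases (yes refl) = begin
      indicator (pos? b)                            ≡⟨ indicator-yes (pos? b) (simple-positive t) ⟩
      1ℚ                                            ≡⟨ cong₂ _+_ (sym (indicator-no (posOff? t b) (λ p → proj₂ p refl)))
                                                                 (sym (δ-diag b)) ⟩
      indicator (posOff? t b) + δ b b               ∎
    by-cases (no b≢t) = begin
      indicator (pos? b)                            ≡⟨ indicator-cong (pos? b) (posOff? t b) (_, b≢t) proj₁ ⟩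
      indicator (posOff? t b)
        ≡⟨ sym (+*δ-off (simple t) b (indicator (posOff? t b)) 1ℚ (λ t≡b → b≢t (sym t≡b))) ⟩
      indicator (posOff? t b) + 1ℚ * δ (simple t) b
        ≡⟨ cong (indicator (posOff? t b) +_) (ℚₚ.*-identityˡ (δ (simple t) b)) ⟩
      indicator (posOff? t b) + δ (simple t) b      ∎

  sum-PosOff-⟪α⟫ : ∀ t → sumℚ (λ b → indicator (posOff? t b) * ⟪ root b , α t ⟫) ≡ 0ℚ
  sum-PosOff-⟪α⟫ t = x≡-x⇒x≡0 (sumℚ g) (begin
    sumℚ g                     ≡⟨ sumℚ-permute g (Perm.permutation (σ t) (σ t) (σ-involutive t) (σ-involutive t)) ⟩
    sumℚ (λ b → g (σ t b))     ≡⟨ sumℚ-cong g∘σ≡-g ⟩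
    sumℚ (λ b → - g b)         ≡⟨ sumℚ-neg g ⟩
    - sumℚ g                   ∎)
    where
    open ≡-Reasoning
    g : Fin N → ℚ
    g b = indicator (posOff? t b) * ⟪ root b , α t ⟫
    g∘σ≡-g : ∀ b → g (σ t b) ≡ - g b
    g∘σ≡-g b = trans (cong₂ _*_ (indicator-PosOff-σ t b) (⟪σ,α⟫ t b))
                     (sym (ℚₚ.neg-distribʳ-* (indicator (posOff? t b)) ⟪ root b , α t ⟫))

  ⟪ρ,α⟫ : ∀ t → ⟪ ρ , α t ⟫ ≡ ⟪ α t , α t ⟫
  ⟪ρ,α⟫ t = begin
    ⟪ ρ , α t ⟫                                  ≡⟨ ⟪linComb⟫ˡ (λ b → indicator (pos? b)) root (α t) ⟩
    sumℚ (λ b → indicator (pos? b) * x b)        ≡⟨ sumℚ-cong split ⟩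
    sumℚ (λ b → g b + δ (simple t) b * x b)      ≡⟨ sumℚ-+ g (λ b → δ (simple t) b * x b) ⟩
    sumℚ g + sumℚ (λ b → δ (simple t) b * x b)   ≡⟨ cong₂ _+_ (sum-PosOff-⟪α⟫ t) (sumℚ-δ (simple t) x) ⟩
    0ℚ + ⟪ α t , α t ⟫                           ≡⟨ ℚₚ.+-identityˡ _ ⟩
    ⟪ α t , α t ⟫                                ∎
    where
    open ≡-Reasoning
    x : Fin N → ℚ
    x b = ⟪ root b , α t ⟫
    g : Fin N → ℚ
    g b = indicator (posOff? t b) * x b
    split : ∀ b → indicator (pos? b) * x b ≡ g b + δ (simple t) b * x b
    split b = trans (cong (_* x b) (indicator-Pos t b))
                    (ℚₚ.*-distribʳ-+ (x b) (indicator (posOff? t b)) (δ (simple t) b))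

  ρ-pos : ∀ b → Pos b → 0ℚ < ⟪ ρ , coroot ip (root b) ⟫
  ρ-pos b (z , b≡Σαz , 0≤z) with Finₚ.any? (λ u → 0ℚ ℚₚ.<? ℤ→ℚ (z u))
  ... | no none = ⊥-elim (nonzero b (trans b≡Σαz (linComb-zero _ α λ u →
                    ℚₚ.≤-antisym (ℚₚ.≮⇒≥ (λ p → none (u , p))) (ℤ→ℚ-mono-≤ (0≤z u)))))
  ... | yes (u , 0<zu) = subst (0ℚ <_) (sym (⟪coroot⟫ʳ ρ (root b)))
                           (*-pos (corootScale-pos (root b) (nonzero b)) 0<⟪ρ,b⟫)
    where
    0<⟪ρ,α⟫ : ∀ i → 0ℚ < ⟪ ρ , α i ⟫
    0<⟪ρ,α⟫ i = subst (0ℚ <_) (sym (⟪ρ,α⟫ i)) (posdef (α i) (α≢0 i))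
    0<⟪ρ,b⟫ : 0ℚ < ⟪ ρ , root b ⟫
    0<⟪ρ,b⟫ = begin-strict
      0ℚ                                       <⟨ *-pos 0<zu (0<⟪ρ,α⟫ u) ⟩
      ℤ→ℚ (z u) * ⟪ ρ , α u ⟫                  ≤⟨ term≤sumℚ (λ i → ℤ→ℚ (z i) * ⟪ ρ , α i ⟫)
                                                    (λ i → *-nonNeg (ℤ→ℚ-mono-≤ (0≤z i)) (ℚₚ.<⇒≤ (0<⟪ρ,α⟫ i))) u ⟩
      sumℚ (λ i → ℤ→ℚ (z i) * ⟪ ρ , α i ⟫)     ≡⟨ sym (⟪linComb⟫ʳ _ α ρ) ⟩
      ⟪ ρ , Σα (λ i → ℤ→ℚ (z i)) ⟫             ≡⟨ cong (λ v → ⟪ ρ , v ⟫) (sym b≡Σαz) ⟩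
      ⟪ ρ , root b ⟫                           ∎
      where open ℚₚ.≤-Reasoning

module IotaSimple {n : ℕ} {ip : InnerProduct n} {R : RootSystem ip} (Δ : Base R) where
  open InnerProduct ip
  open RootSystem R
  open Base Δ
  open Euclidean ip
  open SimpleRoots Δ
  open PositiveRootSum Δ

  fundamentalAlcove-inhabited : ∃ (InAe Δ)
  fundamentalAlcove-inhabited with ∃-uniform-scale<1 (λ b → ⟪ ρ , coroot ip (root b) ⟫)
  ... | ε , 0<ε , ε*<1 = ε · ρ , λ b pos →
    subst (0ℚ <_) (sym (homog ε ρ _)) (*-pos 0<ε (ρ-pos b pos)) ,
    subst (_< 1ℚ) (sym (homog ε ρ _)) (ε*<1 b (ρ-pos b pos))

  module _ (i : Fin n) (k : Fin N → ℤ) (ι : IsIotaSimple Δ i k) where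
    private
      v = proj₁ fundamentalAlcove-inhabited
      v∈Ae = proj₂ fundamentalAlcove-inhabited

    iotaSimple-α : k (simple i) ≡ ℤ.-[1+ 0 ]
    iotaSimple-α with ι (simple i) (simple-positive i) v v∈Ae | v∈Ae (simple i) (simple-positive i)
    ... | k<x , x<k+1 | 0<y , y<1 = ℤ→ℚ-interval-unique (k (simple i)) ℤ.-[1+ 0 ] k<x x<k+1
      (subst (- 1ℚ <_) (sym x≡-y) (ℚₚ.neg-antimono-< y<1))
      (subst (_< 0ℚ) (sym x≡-y) (ℚₚ.neg-antimono-< 0<y))
      where
      x≡-y : ⟪ s (α i) v , coroot ip (α i) ⟫ ≡ - ⟪ v , coroot ip (α i) ⟫
      x≡-y = ⟪s,coroot-self⟫ (α i) v (α≢0 i)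

    iotaSimple-nonSimple : ∀ b → Pos b → root b ≢ α i → k b ≡ ℤ.+ 0
    iotaSimple-nonSimple b pos b≢αi with ι b pos v v∈Ae | v∈Ae (σ i b) (σ-positive i b pos b≢αi)
    ... | k<x , x<k+1 | 0<y , y<1 = ℤ→ℚ-interval-unique (k b) (ℤ.+ 0) k<x x<k+1
      (subst (0ℚ <_) (sym x≡y) 0<y) (subst (_< 1ℚ) (sym x≡y) y<1)
      where
      x≡y : ⟪ s (α i) v , coroot ip (root b) ⟫ ≡ ⟪ v , coroot ip (root (σ i b)) ⟫
      x≡y = trans (⟪s,coroot⟫ (α i) v (root b) (α≢0 i))
                  (cong (λ w → ⟪ v , coroot ip w ⟫) (sym (σ-root i b)))

    iotaSimple-on-simple : ∀ t → ℤ→ℚ (k (simple t)) ≡ - δ i t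
    iotaSimple-on-simple t with t Fin.≟ i
    ... | yes refl = trans (cong ℤ→ℚ iotaSimple-α) (cong -_ (sym (δ-diag t)))
    ... | no  t≢i  = trans (cong ℤ→ℚ (iotaSimple-nonSimple (simple t) (simple-positive t)
                                                           (λ αt≡αi → t≢i (α-injective t i αt≡αi))))
                           (cong -_ (sym (δ-off i t (λ i≡t → t≢i (sym i≡t)))))

    -- Only the α_i^∨-coordinate of θ^∨ survives in P_θ at ι(s_i).
    InX-iotaSimple : ∀ lam → InX Δ lam k → ∀ b → Pos b → root b ≢ α i →
                     ∀ c → CorootCoeffs Δ b c → c i ≡ ℕ→ℚ (lam b)
    InX-iotaSimple lam x∈X b pos b≢αi c cc = begin
      c i                                  ≡⟨ solve 2 (λ c l → c := l :- ((:- c :+ l) :- con 0ℚ)) refl (c i) L ⟩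
      L - ((- c i + L) - 0ℚ)               ≡⟨ cong₂ (λ x y → L - ((x + L) - y)) (sym Σc·k≡-ci) (sym kb≡0) ⟩
      L - (Σc·k + L - ℤ→ℚ (k b))           ≡⟨ cong (λ x → L - x) (x∈X b pos c cc) ⟩
      L - 0ℚ                               ≡⟨ solve 1 (λ l → l :- con 0ℚ := l) refl L ⟩
      L                                    ∎
      where
      open ≡-Reasoning
      L = ℕ→ℚ (lam b)
      kb≡0 : ℤ→ℚ (k b) ≡ 0ℚ
      kb≡0 = cong ℤ→ℚ (iotaSimple-nonSimple b pos b≢αi)
      Σc·k = sumℚ (λ t → c t * ℤ→ℚ (k (simple t)))
      Σc·k≡-ci : Σc·k ≡ - c i
      Σc·k≡-ci = begin
        Σc·k                          ≡⟨ sumℚ-cong term ⟩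
        sumℚ (λ t → - (δ i t * c t))  ≡⟨ sumℚ-neg (λ t → δ i t * c t) ⟩
        - sumℚ (λ t → δ i t * c t)    ≡⟨ cong -_ (sumℚ-δ i c) ⟩
        - c i                         ∎
        where
        term : ∀ t → c t * ℤ→ℚ (k (simple t)) ≡ - (δ i t * c t)
        term t = begin
          c t * ℤ→ℚ (k (simple t))  ≡⟨ cong (c t *_) (iotaSimple-on-simple t) ⟩
          c t * - δ i t             ≡⟨ sym (ℚₚ.neg-distribʳ-* (c t) (δ i t)) ⟩
          - (c t * δ i t)           ≡⟨ cong -_ (ℚₚ.*-comm (c t) (δ i t)) ⟩
          - (δ i t * c t)           ∎

-- Roots separating two simple coroot coordinates

two-cover⇒≡2 : ∀ {n} {i j : Fin n} → i ≢ j → (∀ u → u ≡ i ⊎ u ≡ j) → n ≡ 2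
two-cover⇒≡2 {n} {i} {j} i≢j cover =
  ℕₚ.≤-antisym (Finₚ.injective⇒≤ (λ {u} {v} → index-injective (cover u) (cover v)))
               (Finₚ.injective⇒≤ {f = pick} pick-injective)
  where
  index : ∀ {u} → u ≡ i ⊎ u ≡ j → Fin 2
  index (inj₁ _) = Fin.zero
  index (inj₂ _) = Fin.suc Fin.zero
  index-injective : ∀ {u v} (p : u ≡ i ⊎ u ≡ j) (q : v ≡ i ⊎ v ≡ j) → index p ≡ index q → u ≡ v
  index-injective (inj₁ refl) (inj₁ refl) _ = refl
  index-injective (inj₂ refl) (inj₂ refl) _ = refl
  pick : Fin 2 → Fin n
  pick Fin.zero    = i
  pick (Fin.suc _) = j
  pick-injective : ∀ {x y} → pick x ≡ pick y → x ≡ y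
  pick-injective {Fin.zero}           {Fin.zero}           _   = refl
  pick-injective {Fin.suc Fin.zero}   {Fin.suc Fin.zero}   _   = refl
  pick-injective {Fin.zero}           {Fin.suc Fin.zero}   i≡j = ⊥-elim (i≢j i≡j)
  pick-injective {Fin.suc Fin.zero}   {Fin.zero}           j≡i = ⊥-elim (i≢j (sym j≡i))

module Separation {n : ℕ} {ip : InnerProduct n} {R : RootSystem ip} (Δ : Base R) where
  open InnerProduct ip
  open RootSystem R
  open Base Δ
  open Euclidean ip
  open SimpleRoots Δ
  open IotaSimple Δ
  open Connectedness Δ using (dynkin-connected)

  α∨ : Fin n → V n
  α∨ t = coroot ip (α t)

  θ : Fin n → Fin n → Fin N
  θ l k = σ k (simple l)

  -- d l k = −⟨α_k, α_l^∨⟩, so that θ^∨ = α_l^∨ + d l k α_k^∨ for θ = s_k(α_l)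
  d : Fin n → Fin n → ℚ
  d l k = - (corootScale (α l) * ⟪ α l , α k ⟫)

  θ-coeffs : Fin n → Fin n → Fin n → ℚ
  θ-coeffs l k x = δ l x + d l k * δ k x

  θ-coeffs-l : ∀ l k → k ≢ l → θ-coeffs l k l ≡ 1ℚ
  θ-coeffs-l l k k≢l = trans (+*δ-off k l (δ l l) (d l k) k≢l) (δ-diag l)

  θ-coeffs-k : ∀ l k → l ≢ k → θ-coeffs l k k ≡ d l k
  θ-coeffs-k l k l≢k = begin
    δ l k + d l k * δ k k  ≡⟨ cong₂ (λ x y → x + d l k * y) (δ-off l k l≢k) (δ-diag k) ⟩
    0ℚ + d l k * 1ℚ        ≡⟨ solve 1 (λ x → con 0ℚ :+ x :* con 1ℚ := x) refl (d l k) ⟩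
    d l k                  ∎
    where open ≡-Reasoning

  θ-coeffs-off : ∀ l k x → l ≢ x → k ≢ x → θ-coeffs l k x ≡ 0ℚ
  θ-coeffs-off l k x l≢x k≢x = trans (+*δ-off k x (δ l x) (d l k) k≢x) (δ-off l x l≢x)

  pair≡-d : ∀ a b → pair Δ (α a) (α b) ≡ - d b a
  pair≡-d a b = begin
    ⟪ α a , coroot ip (α b) ⟫               ≡⟨ ⟪coroot⟫ʳ (α a) (α b) ⟩
    corootScale (α b) * ⟪ α a , α b ⟫       ≡⟨ cong (corootScale (α b) *_) (symm (α a) (α b)) ⟩
    corootScale (α b) * ⟪ α b , α a ⟫       ≡⟨ sym (neg-involutive _) ⟩
    - d b a                                  ∎
    where open ≡-Reasoning

  θ-corootCoeffs : ∀ l k → CorootCoeffs Δ (θ l k) (θ-coeffs l k)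
  θ-corootCoeffs l k = begin
    coroot ip (root (θ l k))                              ≡⟨ cong (coroot ip) (σ-root k (simple l)) ⟩
    coroot ip (s (α k) (α l))                             ≡⟨ coroot-s (α k) (α l) (α≢0 k) ⟩
    α∨ l ⊕ d l k · α∨ k
      ≡⟨ cong₂ (λ u w → u ⊕ d l k · w) (sym (linComb-δ l α∨)) (sym (linComb-δ k α∨)) ⟩
    linComb (δ l) α∨ ⊕ d l k · linComb (δ k) α∨           ≡⟨ sym (linComb-+* (δ l) (d l k) (δ k) α∨) ⟩
    linComb (θ-coeffs l k) α∨                             ∎
    where open ≡-Reasoning

  θ-positive : ∀ l k → l ≢ k → Pos (θ l k)
  θ-positive l k l≢k =
    σ-positive k (simple l) (simple-positive l) (λ αl≡αk → l≢k (α-injective l k αl≡αk))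

  θ-nonSimple : ∀ l k → l ≢ k → ⟪ α l , α k ⟫ ≢ 0ℚ → ∀ m → root (θ l k) ≢ α m
  θ-nonSimple l k l≢k adjacent m θ≡αm =
    adjacent (pos*x≡0⇒x≡0 (corootScale (α k)) ⟪ α l , α k ⟫ (corootScale-pos (α k) (α≢0 k)) c*⟪αl,αk⟫≡0)
    where
    r = reflCoeff k (Σα (δ l))
    coord : ∀ x → δ l x + r * δ k x ≡ δ m x
    coord = Σα-injective _ (δ m)
              (trans (sym (σ-coords k (simple l) (δ l) (α≡Σαδ l))) (trans θ≡αm (α≡Σαδ m)))
    m≡l : m ≡ l
    m≡l with m Fin.≟ l
    ... | yes m≡l = m≡l
    ... | no  m≢l = ⊥-elim (1≢0 (begin
      1ℚ                 ≡⟨ sym (δ-diag l) ⟩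
      δ l l              ≡⟨ sym (+*δ-off k l (δ l l) r (λ k≡l → l≢k (sym k≡l))) ⟩
      δ l l + r * δ k l  ≡⟨ coord l ⟩
      δ m l              ≡⟨ δ-off m l m≢l ⟩
      0ℚ                 ∎))
      where open ≡-Reasoning
    r≡0 : r ≡ 0ℚ
    r≡0 = begin
      r                        ≡⟨ solve 1 (λ r → r := con 0ℚ :+ r :* con 1ℚ) refl r ⟩
      0ℚ + r * 1ℚ              ≡⟨ cong₂ (λ x y → x + r * y) (sym (δ-off l k l≢k)) (sym (δ-diag k)) ⟩
      δ l k + r * δ k k        ≡⟨ coord k ⟩
      δ m k                    ≡⟨ cong (λ x → δ x k) m≡l ⟩
      δ l k                    ≡⟨ δ-off l k l≢k ⟩
      0ℚ                       ∎
      where open ≡-Reasoning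
    c*⟪αl,αk⟫≡0 : corootScale (α k) * ⟪ α l , α k ⟫ ≡ 0ℚ
    c*⟪αl,αk⟫≡0 = trans (sym (neg-involutive _))
                        (cong -_ (trans (cong (λ v → - (corootScale (α k) * ⟪ v , α k ⟫)) (α≡Σαδ l)) r≡0))

  Separates : Fin n → Fin n → Set
  Separates i j = ∃ λ b → Pos b × (∀ m → root b ≢ α m) × ∃ λ c → CorootCoeffs Δ b c × c i ≢ c j

  θ-separates : ∀ {i j} l k → l ≢ k → ⟪ α l , α k ⟫ ≢ 0ℚ → θ-coeffs l k i ≢ θ-coeffs l k j →
                Separates i j
  θ-separates l k l≢k adjacent ci≢cj =
    θ l k , θ-positive l k l≢k , θ-nonSimple l k l≢k adjacent , θ-coeffs l k , θ-corootCoeffs l k , ci≢cj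

  iotaSimple-inseparable : ∀ i j ki kj lam → IsIotaSimple Δ i ki → IsIotaSimple Δ j kj →
                           InX Δ lam ki → InX Δ lam kj → ¬ Separates i j
  iotaSimple-inseparable i j ki kj lam ιi ιj xi xj (b , pos , nonSimple , c , cc , ci≢cj) =
    ci≢cj (trans (InX-iotaSimple i ki ιi lam xi b pos (nonSimple i) c cc)
                 (sym (InX-iotaSimple j kj ιj lam xj b pos (nonSimple j) c cc)))

  module _ {i j : Fin n} (i≢j : i ≢ j) where
    private
      j≢i : j ≢ i
      j≢i j≡i = i≢j (sym j≡i)

    Isolated : Fin n → Set
    Isolated l = ∀ k → k ≢ i → k ≢ j → ⟪ α l , α k ⟫ ≡ 0ℚ

    outside-neighbour? : ∀ l → (∃ λ k → k ≢ i × k ≢ j × ⟪ α l , α k ⟫ ≢ 0ℚ) ⊎ Isolated l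
    outside-neighbour? l
      with Finₚ.any? (λ k → ¬? (k Fin.≟ i) ×-dec ¬? (k Fin.≟ j) ×-dec ¬? (⟪ α l , α k ⟫ ℚₚ.≟ 0ℚ))
    ... | yes found = inj₁ found
    ... | no  none  = inj₂ λ k k≢i k≢j →
      decidable-stable (⟪ α l , α k ⟫ ℚₚ.≟ 0ℚ) (λ adjacent → none (k , k≢i , k≢j , adjacent))

    isolated-adjacent : Isolated j → ⟪ α j , α i ⟫ ≢ 0ℚ
    isolated-adjacent isolated ⟪αj,αi⟫≡0 = i≢j (dynkin-connected (Fin._≟ j) orth j i refl)
      where
      orth : ∀ u v → u ≡ j → v ≢ j → ⟪ α u , α v ⟫ ≡ 0ℚ
      orth u v refl v≢j with v Fin.≟ i
      ... | yes refl = ⟪αj,αi⟫≡0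
      ... | no  v≢i  = isolated v v≢i v≢j

    isolated-pair⇒A2 : Isolated i → Isolated j → d j i ≡ 1ℚ → d i j ≡ 1ℚ → IsTypeA2 Δ
    isolated-pair⇒A2 isolated-i isolated-j dji≡1 dij≡1 = two-cover⇒≡2 i≢j cover , cartan
      where
      InPair : Fin n → Set
      InPair u = u ≡ i ⊎ u ≡ j
      orth : ∀ u v → InPair u → ¬ InPair v → ⟪ α u , α v ⟫ ≡ 0ℚ
      orth u v (inj₁ refl) v∉ = isolated-i v (λ v≡i → v∉ (inj₁ v≡i)) (λ v≡j → v∉ (inj₂ v≡j))
      orth u v (inj₂ refl) v∉ = isolated-j v (λ v≡i → v∉ (inj₁ v≡i)) (λ v≡j → v∉ (inj₂ v≡j))
      cover : ∀ u → InPair u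
      cover u = dynkin-connected (λ x → (x Fin.≟ i) ⊎-dec (x Fin.≟ j)) orth i u (inj₁ refl)
      cartan : ∀ a b → a ≢ b → pair Δ (αs Δ a) (αs Δ b) ≡ - 1ℚ
      cartan a b a≢b with cover a | cover b
      ... | inj₁ refl | inj₁ refl = ⊥-elim (a≢b refl)
      ... | inj₁ refl | inj₂ refl = trans (pair≡-d a b) (cong -_ dji≡1)
      ... | inj₂ refl | inj₁ refl = trans (pair≡-d a b) (cong -_ dij≡1)
      ... | inj₂ refl | inj₂ refl = ⊥-elim (a≢b refl)

    separating-root : ¬ IsTypeA2 Δ → Separates i j
    separating-root ¬A2 with outside-neighbour? j | outside-neighbour? i
    ... | inj₁ (k , k≢i , k≢j , adjacent) | _ =
      θ-separates j k (λ j≡k → k≢j (sym j≡k)) adjacent λ ci≡cj →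
        0≢1 (trans (sym (θ-coeffs-off j k i j≢i k≢i)) (trans ci≡cj (θ-coeffs-l j k k≢j)))
    ... | inj₂ _ | inj₁ (k , k≢i , k≢j , adjacent) =
      θ-separates i k (λ i≡k → k≢i (sym i≡k)) adjacent λ ci≡cj →
        0≢1 (trans (sym (θ-coeffs-off i k j i≢j k≢j)) (trans (sym ci≡cj) (θ-coeffs-l i k k≢i)))
    ... | inj₂ isolated-j | inj₂ isolated-i with d j i ℚₚ.≟ 1ℚ | d i j ℚₚ.≟ 1ℚ
    ...   | no dji≢1 | _ =
      θ-separates j i j≢i (isolated-adjacent isolated-j) λ ci≡cj →
        dji≢1 (trans (sym (θ-coeffs-k j i j≢i)) (trans ci≡cj (θ-coeffs-l j i i≢j)))
    ...   | yes _ | no dij≢1 =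
      θ-separates i j i≢j (λ ⟪αi,αj⟫≡0 → isolated-adjacent isolated-j (trans (symm (α j) (α i)) ⟪αi,αj⟫≡0))
        λ ci≡cj →
        dij≢1 (trans (sym (θ-coeffs-k i j i≢j)) (trans (sym ci≡cj) (θ-coeffs-l i j j≢i)))
    ...   | yes dji≡1 | yes dij≡1 = ⊥-elim (¬A2 (isolated-pair⇒A2 isolated-i isolated-j dji≡1 dij≡1))

proposition4p24 : ∀ {n} (ip : InnerProduct n) (R : RootSystem ip) (Δ : Base R) →
    ¬ IsTypeA2 Δ →
    (i j : Fin n) → i ≢ j →
    (ki kj : Fin (RootSystem.N R) → ℤ) → IsIotaSimple Δ i ki → IsIotaSimple Δ j kj →
    (lam : Fin (RootSystem.N R) → ℕ) → Admitted Δ lam →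
    ¬ (InX Δ lam ki × InX Δ lam kj)
proposition4p24 ip R Δ ¬A2 i j i≢j ki kj ιi ιj lam _ (ki∈X , kj∈X) =
  iotaSimple-inseparable i j ki kj lam ιi ιj ki∈X kj∈X (separating-root i≢j ¬A2)
  where open Separation Δ
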